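{- For every integer $n\ge 2$, \[\mathrm{sat}_g(K_{1,3};K_n)=\begin{cases} n & \text{if } n\in\{3,7\}\cup(2\mathbb{N}\setminus\{2\}),\\ n-1 & \text{otherwise,}\end{cases}\qquad \mathrm{sat}_g'(K_{1,3};K_n)=\begin{cases} n-1 & \text{if } n\in 2\mathbb{N}\setminus\{4\},\\ n & \text{otherwise,}\end{cases}\] where $2\mathbb{N}$ denotes the set of positive even integers. In particular, for $n\ge 8$, $\mathrm{sat}_g(K_{1,3};K_n)=2\lfloor n/2\rfloor$ and $\mathrm{sat}_g'(K_{1,3};K_n)=2\lceil n/2\rceil-1$.
   Context: Let $\mathcal{F}$ be a family of graphs and $H$ a host graph. A subgraph $G\subseteq H$ is $\mathcal{F}$-saturated relative to $H$ if no subgraph of $G$ belongs to $\mathcal{F}$ but adding any edge of $E(H)-E(G)$ to $G$ creates a subgraph in $\mathcal{F}$. In the $\mathcal{F}$-saturation game on $H$, two players Max and Min alternately add one edge of $H$ to a graph $G$ (initially with vertex set $V(H)$ and no edges), subject to $G$ never containing a subgraph in $\mathcal{F}$; the game ends when $G$ becomes $\mathcal{F}$-saturated relative to $H$. Max tries to maximize and Min to minimize the number of edges played. Under optimal play, the length of the game is denoted $\mathrm{sat}_g(\mathcal{F};H)$ when Max moves first and $\mathrm{sat}_g'(\mathcal{F};H)$ when Min moves first; when $\mathcal{F}=\{F\}$ we write $F$. $K_{1,3}$ is the claw (star with three edges) and $K_n$ the complete graph on $n$ vertices. -}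

module Defs where

open import Data.Nat using (ℕ; zero; suc; _⊔_; _⊓_; _*_)
open import Data.Bool using (Bool; true; false; _∨_; _∧_; if_then_else_)
open import Data.Fin using (Fin; _<_; _≟_; _<?_)
open import Data.Fin.Properties using (any?)
open import Data.List using (List; []; _∷_; filter; allFin; concatMap; map)
open import Data.Product using (_×_; _,_; ∃; Σ-syntax; ∃-syntax; proj₁; proj₂)
open import Relation.Binary.PropositionalEquality using (_≡_; _≢_)
open import Relation.Nullary using (Dec; yes; no; ¬_; does)
open import Relation.Nullary.Decidable using (_×-dec_; ¬?)
open import Data.Bool.Properties using () renaming (_≟_ to _≟ᵇ_)

-- A (simple) graph on vertex set Fin n, given by its adjacency relation.
-- Graphs arising in the game are always symmetric and loopless.
Graph : ℕ → Set
Graph n = Fin n → Fin n → Bool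

empty : ∀ {n} → Graph n
empty _ _ = false

addEdge : ∀ {n} → Graph n → Fin n → Fin n → Graph n
addEdge G i j x y =
  G x y ∨ ((does (x ≟ i) ∧ does (y ≟ j)) ∨ (does (x ≟ j) ∧ does (y ≟ i)))

ClawAt : ∀ {n} → Graph n → Fin n → Fin n → Fin n → Fin n → Set
ClawAt G v a b c =
  (v ≢ a) × (v ≢ b) × (v ≢ c) × (a ≢ b) × (a ≢ c) × (b ≢ c) ×
  (G v a ≡ true) × (G v b ≡ true) × (G v c ≡ true)

ContainsClaw : ∀ {n} → Graph n → Set
ContainsClaw G = ∃ λ v → ∃ λ a → ∃ λ b → ∃ λ c → ClawAt G v a b c

clawAt? : ∀ {n} (G : Graph n) v a b c → Dec (ClawAt G v a b c)
clawAt? G v a b c =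
  ¬? (v ≟ a) ×-dec ¬? (v ≟ b) ×-dec ¬? (v ≟ c) ×-dec ¬? (a ≟ b) ×-dec
  ¬? (a ≟ c) ×-dec ¬? (b ≟ c) ×-dec
  (G v a ≟ᵇ true) ×-dec (G v b ≟ᵇ true) ×-dec (G v c ≟ᵇ true)

containsClaw? : ∀ {n} (G : Graph n) → Dec (ContainsClaw G)
containsClaw? G =
  any? λ v → any? λ a → any? λ b → any? λ c → clawAt? G v a b c

edgesK : (n : ℕ) → List (Fin n × Fin n)
edgesK n = filter (λ e → proj₁ e <? proj₂ e)
                  (concatMap (λ i → map (λ j → (i , j)) (allFin n)) (allFin n))

LegalMove : ∀ {n} → Graph n → Fin n × Fin n → Set
LegalMove G (i , j) = (G i j ≡ false) × ¬ ContainsClaw (addEdge G i j)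

legal? : ∀ {n} (G : Graph n) (e : Fin n × Fin n) → Dec (LegalMove G e)
legal? G (i , j) = (G i j ≟ᵇ false) ×-dec ¬? (containsClaw? (addEdge G i j))

legalMoves : ∀ {n} → Graph n → List (Fin n × Fin n)
legalMoves {n} G = filter (legal? G) (edgesK n)

data Player : Set where
  Max Min : Player

other : Player → Player
other Max = Min
other Min = Max

maxOver minOver : {A : Set} → (A → ℕ) → A → List A → ℕ
maxOver f x []       = f x
maxOver f x (y ∷ ys) = f x ⊔ maxOver f y ys
minOver f x []       = f x
minOver f x (y ∷ ys) = f x ⊓ minOver f y ys

-- The game ends when no
-- legal move exists, i.e. when G is K_{1,3}-saturated relative to K_n.
-- The first argument is fuel; every move adds a new edge of K_n, so fuel
-- n * n (more than the number of edges of K_n) is never exhausted.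
gameValue : ∀ {n} → ℕ → Player → Graph n → ℕ
gameValue zero     p G = 0
gameValue (suc f) p G with legalMoves G
... | []     = 0
... | e ∷ es with p
...   | Max = suc (maxOver (λ m → gameValue f Min (addEdge G (proj₁ m) (proj₂ m))) e es)
...   | Min = suc (minOver (λ m → gameValue f Max (addEdge G (proj₁ m) (proj₂ m))) e es)

satg : ℕ → ℕ
satg n = gameValue {n} (n * n) Max empty

satg' : ℕ → ℕ
satg' n = gameValue {n} (n * n) Min empty

module Submission where

-- A spanning subgraph of K_n contains no claw exactly when it has maximum
-- degree two, i.e. it is a disjoint union of paths and cycles, and a legal
-- move joins two vertices of degree at most one.  For the game such a graph
-- is described by its profile (a , b , c): the numbers of isolated vertices,
-- of single-edge components and of paths on at least three vertices.  Every
-- legal move changes the profile by one of six abstract moves, each lowering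
-- the number a + b + c of path components by one; conversely every abstract
-- move is made by some legal move.  The game stops with at most one path
-- left, so its length is n, minus one exactly when a path survives.

open import Defs
open import Data.Nat using (ℕ; zero; suc; pred; _+_; _∸_; _*_; _≤_; _<_; z≤n; s≤s; _≡ᵇ_; _<ᵇ_; _⊔_; _⊓_; ⌊_/2⌋; ⌈_/2⌉)
open import Data.Nat using () renaming (_≟_ to _≟ℕ_)
open import Data.Nat.Properties using (+-suc; +-comm; +-assoc; +-identityʳ; +-monoˡ-≤; +-cancelʳ-≡; ≤-refl; ≤-pred; ≤-trans; n≤1+n; ≮⇒≥; m+[n∸m]≡n; _<?_; suc-injective; n≤0⇒n≡0; 0∸n≡0; m∸n≤m; ⊔-idem; ⊓-idem; m≤n⇒m⊔n≡n; m≥n⇒m⊔n≡m; m≤n⇒m⊓n≡m; m≥n⇒m⊓n≡n; m≤m*n; n≡⌊n+n/2⌋; ≤ᵇ⇒≤; 1+n≰n)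
open import Data.Nat.Divisibility using (_∣_; _∣?_; m∣m*n; ∣m+n∣m⇒∣n; ∣1⇒≡1)
open import Data.Bool using (Bool; true; false; _∧_; _∨_; not; if_then_else_)
open import Data.Bool.Properties using (∨-identityʳ; ∨-comm; ∧-comm; ∨-zeroʳ; ∧-identityʳ)
open import Data.Bool.ListAction using (all; any)
open import Data.Fin using (Fin; zero; suc; _≟_) renaming (_<_ to _<ᶠ_; _<?_ to _<ᶠ?_)
open import Data.Fin.Properties using (<-cmp; <⇒≢) renaming (suc-injective to suc-injectiveᶠ)
open import Data.List using (List; []; _∷_; length; map; upTo; allFin; concatMap)
open import Data.List.Membership.Propositional using (_∈_)
open import Data.List.Membership.Propositional.Properties using (∈-upTo⁺; ∈-filter⁺; ∈-filter⁻; ∈-concatMap⁺; ∈-map⁺; ∈-allFin)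
open import Data.List.Relation.Unary.All using (All; []; _∷_)
open import Data.List.Relation.Unary.Any using (here; there)
import Data.List.Relation.Unary.Any as Any
open import Data.Product using (∃; _×_; _,_; proj₁; proj₂)
open import Data.Sum using (_⊎_; inj₁; inj₂)
open import Data.Unit using (⊤; tt)
open import Data.Empty using (⊥; ⊥-elim)
open import Relation.Binary.PropositionalEquality using (_≡_; _≢_; refl; sym; trans; cong; cong₂; subst; module ≡-Reasoning)
open import Relation.Binary.Definitions using (tri<; tri≈; tri>)
open import Relation.Nullary using (¬_; Dec; yes; no; does)
open import Relation.Nullary.Decidable using (_×-dec_; _⊎-dec_; ¬?; dec-true; dec-false)


module Counting where

  indicator : Bool → ℕ
  indicator true  = 1
  indicator false = 0

  count : ∀ {n} → (Fin n → Bool) → ℕ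
  count {zero}  f = 0
  count {suc n} f = indicator (f zero) + count (λ i → f (suc i))

  count-cong : ∀ {n} (f g : Fin n → Bool) → (∀ i → f i ≡ g i) → count f ≡ count g
  count-cong {zero}  f g e = refl
  count-cong {suc n} f g e =
    cong₂ _+_ (cong indicator (e zero)) (count-cong _ _ (λ i → e (suc i)))

  count-false : ∀ n → count {n} (λ _ → false) ≡ 0
  count-false zero    = refl
  count-false (suc n) = count-false n

  count-true : ∀ n → count {n} (λ _ → true) ≡ n
  count-true zero    = refl
  count-true (suc n) = cong suc (count-true n)

  count-zero : ∀ {n} (f : Fin n → Bool) → count f ≡ 0 → ∀ v → f v ≡ false
  count-zero {suc n} f e v with f zero in f0
  count-zero {suc n} f e zero    | false = f0
  count-zero {suc n} f e (suc v) | false = count-zero (λ i → f (suc i)) e v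

  count-exchange : ∀ {n} (f g : Fin n → Bool) x → (∀ v → v ≢ x → f v ≡ g v) →
    count f + indicator (g x) ≡ count g + indicator (f x)
  count-exchange {suc n} f g zero agree
    rewrite count-cong (λ i → f (suc i)) (λ i → g (suc i)) (λ i → agree (suc i) (λ ()))
    = swap (indicator (f zero)) (count (λ i → g (suc i))) (indicator (g zero))
    where
    swap : ∀ a t b → (a + t) + b ≡ (b + t) + a
    swap a t b = trans (+-comm (a + t) b) (trans (cong (b +_) (+-comm a t)) (sym (+-assoc b t a)))
  count-exchange {suc n} f g (suc x) agree
    rewrite agree zero (λ ())
          | +-assoc (indicator (g zero)) (count (λ i → f (suc i))) (indicator (g (suc x)))
          | +-assoc (indicator (g zero)) (count (λ i → g (suc i))) (indicator (f (suc x)))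
    = cong (indicator (g zero) +_)
        (count-exchange (λ i → f (suc i)) (λ i → g (suc i)) x
           (λ v v≢x → agree (suc v) (λ q → v≢x (suc-injectiveᶠ q))))

  update : ∀ {n} → (Fin n → Bool) → Fin n → Bool → Fin n → Bool
  update f x b v = if does (v ≟ x) then b else f v

  update-at : ∀ {n} (f : Fin n → Bool) x b → update f x b x ≡ b
  update-at f x b rewrite dec-true (x ≟ x) refl = refl

  update-off : ∀ {n} (f : Fin n → Bool) x b v → v ≢ x → update f x b v ≡ f v
  update-off f x b v v≢x rewrite dec-false (v ≟ x) v≢x = refl

  count-remove : ∀ {n} (f : Fin n → Bool) x → count f ≡ count (update f x false) + indicator (f x)
  count-remove f x =
    trans (sym (+-identityʳ (count f)))
      (trans (cong (λ b → count f + indicator b) (sym (update-at f x false)))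
        (count-exchange f (update f x false) x (λ v v≢x → sym (update-off f x false v v≢x))))

  count-remove-true : ∀ {n} (f : Fin n → Bool) x → f x ≡ true → count f ≡ suc (count (update f x false))
  count-remove-true f x fx =
    trans (count-remove f x) (trans (cong (λ b → count (update f x false) + indicator b) fx) (+-comm _ 1))

  count-remove-≤ : ∀ {n} (f : Fin n → Bool) x → count f ≤ suc (count (update f x false))
  count-remove-≤ f x rewrite count-remove f x | +-comm (count (update f x false)) (indicator (f x)) =
    +-monoˡ-≤ _ (indicator≤1 (f x))
    where
    indicator≤1 : ∀ b → indicator b ≤ 1
    indicator≤1 true  = s≤s z≤n
    indicator≤1 false = z≤n

  NotIn : ∀ {n} → Fin n → List (Fin n) → Set
  NotIn v []       = ⊤
  NotIn v (x ∷ xs) = v ≢ x × NotIn v xs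

  Distinct : ∀ {n} → List (Fin n) → Set
  Distinct []       = ⊤
  Distinct (x ∷ xs) = NotIn x xs × Distinct xs

  count-≥ : ∀ {n} (f : Fin n → Bool) xs → Distinct xs → All (λ x → f x ≡ true) xs → length xs ≤ count f
  count-≥ f []       _            _          = z≤n
  count-≥ f (x ∷ xs) (x∉xs , dxs) (fx ∷ fxs) rewrite count-remove-true f x fx =
    s≤s (count-≥ (update f x false) xs dxs (keep xs x∉xs fxs))
    where
    keep : ∀ ys → NotIn x ys → All (λ y → f y ≡ true) ys → All (λ y → update f x false y ≡ true) ys
    keep []       _            []         = []
    keep (y ∷ ys) (y≢x , x∉ys) (fy ∷ fys) =
      trans (update-off f x false y (λ q → y≢x (sym q))) fy ∷ keep ys x∉ys fys

  count-witness : ∀ {n} (f : Fin n → Bool) xs → length xs < count f → ∃ λ v → NotIn v xs × f v ≡ true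
  count-witness f [] lt = first f lt
    where
    first : ∀ {n} (f : Fin n → Bool) → 1 ≤ count f → ∃ λ v → ⊤ × f v ≡ true
    first {suc n} f le with f zero in f0
    ... | true  = zero , tt , f0
    ... | false with first (λ i → f (suc i)) le
    ...   | v , _ , fv = suc v , tt , fv
  count-witness f (x ∷ xs) lt
    with count-witness (update f x false) xs (≤-pred (≤-trans lt (count-remove-≤ f x)))
  ... | v , v∉xs , fv′ = v , (v≢x , v∉xs) , trans (sym (update-off f x false v v≢x)) fv′
    where
    v≢x : v ≢ x
    v≢x refl with () ← trans (sym fv′) (update-at f v false)

  count-one : ∀ {n} (f : Fin n → Bool) → count f ≡ 1 → ∀ x y → f x ≡ true → f y ≡ true → x ≡ y
  count-one f c1 x y fx fy with x ≟ y
  ... | yes x≡y = x≡y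
  ... | no x≢y with s≤s () ← subst (2 ≤_) c1 (count-≥ f (x ∷ y ∷ []) ((x≢y , tt) , tt , tt) (fx ∷ fy ∷ []))

  count-only : ∀ {n} (f : Fin n → Bool) w → (∀ u → f u ≡ true → u ≡ w) → count f ≡ indicator (f w)
  count-only {n} f w only =
    trans (sym (+-identityʳ (count f)))
      (trans (count-exchange f (λ _ → false) w off) (cong (_+ indicator (f w)) (count-false n)))
    where
    off : ∀ v → v ≢ w → f v ≡ false
    off v v≢w with f v in fv
    ... | false = refl
    ... | true  = ⊥-elim (v≢w (only v fv))

  countAlong : ∀ {n} → (Fin n → Bool) → List (Fin n) → ℕ
  countAlong f []       = 0
  countAlong f (x ∷ xs) = indicator (f x) + countAlong f xs

  count-along : ∀ {n} (f g : Fin n → Bool) xs → Distinct xs → (∀ v → NotIn v xs → f v ≡ g v) →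
    count g + countAlong f xs ≡ count f + countAlong g xs
  count-along f g [] _ agree =
    trans (+-identityʳ _) (trans (count-cong g f (λ v → sym (agree v tt))) (sym (+-identityʳ _)))
  count-along f g (x ∷ xs) (x∉xs , dxs) agree = begin
      count g + (indicator (f x) + countAlong f xs)  ≡⟨ shuffle (count g) (indicator (f x)) _ ⟩
      (count g + countAlong f xs) + indicator (f x)  ≡⟨ cong (_+ indicator (f x)) along-h ⟩
      (count h + countAlong g xs) + indicator (f x)  ≡⟨ trans (+-assoc (count h) _ _) (shuffle (count h) _ _) ⟩
      (count h + indicator (f x)) + countAlong g xs  ≡⟨ cong (_+ countAlong g xs) at-x ⟨
      (count f + indicator (g x)) + countAlong g xs  ≡⟨ +-assoc (count f) _ _ ⟩
      count f + (indicator (g x) + countAlong g xs)  ∎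
    where
    open ≡-Reasoning
    h = update f x (g x)
    shuffle : ∀ a b c → a + (b + c) ≡ (a + c) + b
    shuffle a b c = trans (cong (a +_) (+-comm b c)) (sym (+-assoc a c b))
    at-x : count f + indicator (g x) ≡ count h + indicator (f x)
    at-x = subst (λ b → count f + indicator b ≡ count h + indicator (f x)) (update-at f x (g x))
             (count-exchange f h x (λ v v≢x → sym (update-off f x (g x) v v≢x)))
    h-agree : ∀ v → NotIn v xs → h v ≡ g v
    h-agree v v∉xs with v ≟ x
    ... | yes refl = refl
    ... | no v≢x   = agree v (v≢x , v∉xs)
    along-update : ∀ ys → NotIn x ys → countAlong h ys ≡ countAlong f ys
    along-update []       _            = refl
    along-update (y ∷ ys) (x≢y , x∉ys) =
      cong₂ _+_ (cong indicator (update-off f x (g x) y (λ q → x≢y (sym q)))) (along-update ys x∉ys)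
    along-h : count g + countAlong f xs ≡ count h + countAlong g xs
    along-h = trans (cong (count g +_) (sym (along-update xs x∉xs))) (count-along h g xs dxs h-agree)

open Counting

module BoolQuantifiers {A : Set} (g : A → Bool) where

  all-true : ∀ xs → all g xs ≡ true → ∀ {x} → x ∈ xs → g x ≡ true
  all-true (y ∷ ys) h (here refl) with g y
  ... | true = refl
  all-true (y ∷ ys) h (there x∈ys) with g y
  ... | true = all-true ys h x∈ys

  all-false : ∀ xs → all g xs ≡ false → ∃ λ x → x ∈ xs × g x ≡ false
  all-false (y ∷ ys) h with g y in gy
  ... | false = y , here refl , gy
  ... | true with all-false ys h
  ...   | x , x∈ys , gx = x , there x∈ys , gx

  any-true : ∀ xs → any g xs ≡ true → ∃ λ x → x ∈ xs × g x ≡ true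
  any-true (y ∷ ys) h with g y in gy
  ... | true = y , here refl , gy
  ... | false with any-true ys h
  ...   | x , x∈ys , gx = x , there x∈ys , gx

  any-false : ∀ xs → any g xs ≡ false → ∀ {x} → x ∈ xs → g x ≡ false
  any-false (y ∷ ys) h (here refl) with g y
  ... | false = refl
  any-false (y ∷ ys) h (there x∈ys) with g y
  ... | false = any-false ys h x∈ys

  all-true-intro : ∀ xs → (∀ {x} → x ∈ xs → g x ≡ true) → all g xs ≡ true
  all-true-intro xs h with all g xs in e
  ... | true  = refl
  ... | false with x , x∈xs , gx ← all-false xs e with () ← trans (sym (h x∈xs)) gx

  all-false-intro : ∀ xs {x} → x ∈ xs → g x ≡ false → all g xs ≡ false
  all-false-intro xs x∈xs gx with all g xs in e
  ... | false = refl
  ... | true with () ← trans (sym (all-true xs e x∈xs)) gx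

  any-true-intro : ∀ xs {x} → x ∈ xs → g x ≡ true → any g xs ≡ true
  any-true-intro xs x∈xs gx with any g xs in e
  ... | true  = refl
  ... | false with () ← trans (sym gx) (any-false xs e x∈xs)

  any-false-intro : ∀ xs → (∀ {x} → x ∈ xs → g x ≡ false) → any g xs ≡ false
  any-false-intro xs h with any g xs in e
  ... | false = refl
  ... | true with x , x∈xs , gx ← any-true xs e with () ← trans (sym gx) (h x∈xs)

open BoolQuantifiers

-- A graph of maximum degree two is described, as far as
-- the game is concerned, by its profile (a , b , c): a isolated vertices,
-- b components that are a single edge, c paths with at least three
-- vertices.  Cycles are irrelevant: they can never be touched again.
module AbstractGame where

  Profile : Set
  Profile = ℕ × ℕ × ℕ

  -- the number of path components (isolated vertices count as paths)
  potential : Profile → ℕ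
  potential (a , b , c) = a + (b + c)

  positive atLeastTwo : ℕ → Bool
  positive zero    = false
  positive (suc _) = true
  atLeastTwo (suc (suc _)) = true
  atLeastTwo _             = false

  nonempty : Profile → Bool
  nonempty (a , b , c) = positive a ∨ positive b ∨ positive c

  -- The effect of a legal move on the profile, named by the kinds of the
  -- two components that are joined (pathPath also covers closing a path
  -- into a cycle).
  data Move : Profile → Profile → Set where
    isoIso   : ∀ {a b c} → Move (suc (suc a) , b , c) (a , suc b , c)
    isoEdge  : ∀ {a b c} → Move (suc a , suc b , c) (a , b , suc c)
    isoPath  : ∀ {a b c} → Move (suc a , b , suc c) (a , b , suc c)
    edgeEdge : ∀ {a b c} → Move (a , suc (suc b) , c) (a , b , suc c)
    edgePath : ∀ {a b c} → Move (a , suc b , suc c) (a , b , suc c)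
    pathPath : ∀ {a b c} → Move (a , b , suc c) (a , b , c)

  move-potential : ∀ {s t} → Move s t → potential s ≡ suc (potential t)
  move-potential {suc (suc a) , b , c} isoIso = cong suc (sym (+-suc a (b + c)))
  move-potential {suc a , suc b , c} isoEdge = cong (λ x → suc (a + x)) (sym (+-suc b c))
  move-potential {suc a , b , suc c} isoPath = refl
  move-potential {a , suc (suc b) , c} edgeEdge =
    trans (+-suc a (suc b + c)) (cong (λ x → suc (a + x)) (sym (+-suc b c)))
  move-potential {a , suc b , suc c} edgePath = +-suc a (b + suc c)
  move-potential {a , b , suc c} pathPath = trans (cong (a +_) (+-suc b c)) (+-suc a (b + c))

  -- Move kinds, with a Boolean availability test and the resulting profile;
  -- this turns Move into something that can be computed with.
  data Kind : Set where
    isoIso isoEdge isoPath edgeEdge edgePath pathPath : Kind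

  kinds : List Kind
  kinds = isoIso ∷ isoEdge ∷ isoPath ∷ edgeEdge ∷ edgePath ∷ pathPath ∷ []

  kinds-complete : ∀ k → k ∈ kinds
  kinds-complete isoIso   = here refl
  kinds-complete isoEdge  = there (here refl)
  kinds-complete isoPath  = there (there (here refl))
  kinds-complete edgeEdge = there (there (there (here refl)))
  kinds-complete edgePath = there (there (there (there (here refl))))
  kinds-complete pathPath = there (there (there (there (there (here refl)))))

  available : Kind → Profile → Bool
  available isoIso   (a , b , c) = atLeastTwo a
  available isoEdge  (a , b , c) = positive a ∧ positive b
  available isoPath  (a , b , c) = positive a ∧ positive c
  available edgeEdge (a , b , c) = atLeastTwo b
  available edgePath (a , b , c) = positive b ∧ positive c
  available pathPath (a , b , c) = positive c

  after : Kind → Profile → Profile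
  after isoIso   (a , b , c) = a ∸ 2 , suc b , c
  after isoEdge  (a , b , c) = a ∸ 1 , b ∸ 1 , suc c
  after isoPath  (a , b , c) = a ∸ 1 , b , c
  after edgeEdge (a , b , c) = a , b ∸ 2 , suc c
  after edgePath (a , b , c) = a , b ∸ 1 , c
  after pathPath (a , b , c) = a , b , c ∸ 1

  move-kind : ∀ {s t} → Move s t → ∃ λ k → available k s ≡ true × after k s ≡ t
  move-kind isoIso   = isoIso , refl , refl
  move-kind isoEdge  = isoEdge , refl , refl
  move-kind isoPath  = isoPath , refl , refl
  move-kind edgeEdge = edgeEdge , refl , refl
  move-kind edgePath = edgePath , refl , refl
  move-kind pathPath = pathPath , refl , refl

  kind-move : ∀ k s → available k s ≡ true → Move s (after k s)
  kind-move isoIso   (suc (suc a) , b , c)     _ = isoIso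
  kind-move isoEdge  (suc a , suc b , c)       _ = isoEdge
  kind-move isoPath  (suc a , b , suc c)       _ = isoPath
  kind-move edgeEdge (a , suc (suc b) , c)     _ = edgeEdge
  kind-move edgePath (a , suc b , suc c)       _ = edgePath
  kind-move pathPath (a , b , suc c)           _ = pathPath

  allMoves anyMove : (Profile → Bool) → Profile → Bool
  allMoves f s = all (λ k → not (available k s) ∨ f (after k s)) kinds
  anyMove  f s = any (λ k → available k s ∧ f (after k s)) kinds

  allMoves-true : ∀ f s → allMoves f s ≡ true → ∀ {t} → Move s t → f t ≡ true
  allMoves-true f s h m with k , avail , refl ← move-kind m
    with all-true (λ k → not (available k s) ∨ f (after k s)) kinds h (kinds-complete k)
  ... | fk rewrite avail = fk

  allMoves-false : ∀ f s → allMoves f s ≡ false → ∃ λ t → Move s t × f t ≡ false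
  allMoves-false f s h with all-false (λ k → not (available k s) ∨ f (after k s)) kinds h
  ... | k , _ , fk with available k s in avail | f (after k s) in ft
  ...   | true | false = after k s , kind-move k s avail , ft

  anyMove-true : ∀ f s → anyMove f s ≡ true → ∃ λ t → Move s t × f t ≡ true
  anyMove-true f s h with any-true (λ k → available k s ∧ f (after k s)) kinds h
  ... | k , _ , fk with available k s in avail | f (after k s) in ft
  ...   | true | true = after k s , kind-move k s avail , ft

  anyMove-false : ∀ f s → anyMove f s ≡ false → ∀ {t} → Move s t → f t ≡ false
  anyMove-false f s h m with k , avail , refl ← move-kind m
    with any-false (λ k → available k s ∧ f (after k s)) kinds h (kinds-complete k)
  ... | fk rewrite avail = fk

  -- The outcome of optimal play.  survives p s says whether, from profile s
  -- with p to move, optimal play ends with a path component left over (Min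
  -- wins) rather than with a spanning union of cycles (Max wins).  It is
  -- given by an explicit table, eventually 2-periodic in every coordinate;
  -- survives-equation below shows that it solves the minimax recursion.
  even odd : ℕ → Bool
  even zero          = true
  even (suc zero)    = false
  even (suc (suc n)) = even n
  odd n = not (even n)

  _∈ᵇ_ : ℕ → List ℕ → Bool
  b ∈ᵇ xs = any (b ≡ᵇ_) xs

  -- The tables below take the first two profile entries a and b.
  -- Max to move, no long path
  maxNoPath : ℕ → ℕ → Bool
  maxNoPath 0 b = odd b
  maxNoPath 1 b = even b
  maxNoPath 2 b = b ≡ᵇ 0
  maxNoPath 3 b = false
  maxNoPath 4 b = b ∈ᵇ (1 ∷ 3 ∷ [])
  maxNoPath 5 b = b ∈ᵇ (0 ∷ 2 ∷ 4 ∷ [])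
  maxNoPath 7 b = false
  maxNoPath a b = if even a then b ≡ᵇ 1 else b ∈ᵇ (0 ∷ 2 ∷ [])

  minNoPath : ℕ → ℕ → Bool
  minNoPath 0 b = b ≡ᵇ 1
  minNoPath 1 b = b ≡ᵇ 0
  minNoPath 2 b = even b
  minNoPath 3 b = odd b
  minNoPath 4 b = b ≡ᵇ 2
  minNoPath 5 b = false
  minNoPath a b = if even a then b ∈ᵇ (0 ∷ 2 ∷ []) else b ∈ᵇ (1 ∷ 3 ∷ [])

  minOnePath : ℕ → ℕ → Bool
  minOnePath 0 b = odd b
  minOnePath 1 b = even b
  minOnePath 2 b = b ∈ᵇ (0 ∷ 1 ∷ [])
  minOnePath 4 b = b ∈ᵇ (1 ∷ 3 ∷ [])
  minOnePath 5 b = b ∈ᵇ (0 ∷ 2 ∷ 4 ∷ [])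
  minOnePath a b = if even a then b ≡ᵇ 1 else b ∈ᵇ (0 ∷ 2 ∷ [])

  onePath : ℕ → ℕ → Bool
  onePath 0 b = false
  onePath 1 b = false
  onePath 4 b = false
  onePath 5 b = false
  onePath a b = if even a then b ≡ᵇ 0 else b ≡ᵇ 1

  twoPaths : ℕ → ℕ → Bool
  twoPaths a b = odd a ∧ not (a <ᵇ 9) ∧ (b ≡ᵇ 0)

  table : Player → ℕ → ℕ → ℕ → Bool
  table Max a b 0 = maxNoPath a b
  table Max a b 1 = onePath a b
  table Max a b 2 = twoPaths a b
  table Max a b _ = false
  table Min a b 0 = minNoPath a b
  table Min a b 1 = minOnePath a b
  table Min a b (suc (suc c)) = table Max a b (suc c)

  -- clip n = n below 10, and 8 or 9 (by parity) above; the table only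
  -- depends on clipped coordinates, and clipping inside survives makes this
  -- periodicity hold by computation.
  clip : ℕ → ℕ
  clip (suc (suc n@(suc (suc (suc (suc (suc (suc (suc (suc _)))))))))) = clip n
  clip n = n

  survives : Player → Profile → Bool
  survives p (a , b , c) = table p (clip a) (clip b) (clip c)

  hasMove : Profile → Bool
  hasMove = anyMove (λ _ → true)

  minimax : Player → Profile → Bool
  minimax Max s = if hasMove s then allMoves (survives Min) s else nonempty s
  minimax Min s = if hasMove s then anyMove (survives Max) s else nonempty s

  _⇔ᵇ_ : Bool → Bool → Bool
  true  ⇔ᵇ y = y
  false ⇔ᵇ y = not y

  ⇔ᵇ-sound : ∀ {x y} → (x ⇔ᵇ y) ≡ true → x ≡ y
  ⇔ᵇ-sound {true}  {true}  _ = refl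
  ⇔ᵇ-sound {false} {false} _ = refl

  solves : Profile → Bool
  solves s = (survives Max s ⇔ᵇ minimax Max s) ∧ (survives Min s ⇔ᵇ minimax Min s)

  solves-box : all (λ a → all (λ b → all (λ c → solves (a , b , c)) (upTo 12)) (upTo 12)) (upTo 12) ≡ true
  solves-box = refl

  periodic₁ : ∀ x b c → solves (12 + x , b , c) ≡ solves (10 + x , b , c)
  periodic₁ x b c = refl

  periodic₂ : ∀ a x c → solves (a , 12 + x , c) ≡ solves (a , 10 + x , c)
  periodic₂ a x c = refl

  periodic₃ : ∀ a b x → solves (a , b , 12 + x) ≡ solves (a , b , 10 + x)
  periodic₃ a b x = refl

  periodic-induction : (Q : ℕ → Set) → (∀ k → k < 12 → Q k) → (∀ x → Q (10 + x) → Q (12 + x)) → ∀ n → Q n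
  periodic-induction Q base step n with n <? 12
  ... | yes n<12 = base n n<12
  ... | no  n≮12 = subst Q (m+[n∸m]≡n 10≤n) (from10 (n ∸ 10))
    where
    10≤n : 10 ≤ n
    10≤n = ≤-trans (≤-trans (n≤1+n 10) (n≤1+n 11)) (≮⇒≥ n≮12)
    from10 : ∀ x → Q (10 + x)
    from10 0             = base 10 (n≤1+n 11)
    from10 1             = base 11 ≤-refl
    from10 (suc (suc x)) = step x (from10 x)

  solves-everywhere : ∀ s → solves s ≡ true
  solves-everywhere (a , b , c) =
    periodic-induction (λ a → ∀ b c → solves (a , b , c) ≡ true)
      (λ a a<12 → periodic-induction (λ b → ∀ c → solves (a , b , c) ≡ true)
        (λ b b<12 → periodic-induction (λ c → solves (a , b , c) ≡ true)
          (λ c c<12 → in-box a b c a<12 b<12 c<12)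
          (λ x h → trans (periodic₃ a b x) h))
        (λ x h c → trans (periodic₂ a x c) (h c)))
      (λ x h b c → trans (periodic₁ x b c) (h b c)) a b c
    where
    in-box : ∀ a b c → a < 12 → b < 12 → c < 12 → solves (a , b , c) ≡ true
    in-box a b c a<12 b<12 c<12 =
      all-true (λ c → solves (a , b , c)) (upTo 12)
        (all-true (λ b → all (λ c → solves (a , b , c)) (upTo 12)) (upTo 12)
          (all-true (λ a → all (λ b → all (λ c → solves (a , b , c)) (upTo 12)) (upTo 12)) (upTo 12)
            solves-box (∈-upTo⁺ a<12))
          (∈-upTo⁺ b<12))
        (∈-upTo⁺ c<12)

  survives-equation : ∀ p s → survives p s ≡ minimax p s
  survives-equation p s = for p (solves-everywhere s)
    where
    for : ∀ p → solves s ≡ true → survives p s ≡ minimax p s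
    for Max h with survives Max s ⇔ᵇ minimax Max s in e
    ... | true = ⇔ᵇ-sound e
    for Min h with survives Max s ⇔ᵇ minimax Max s | survives Min s ⇔ᵇ minimax Min s in e
    ... | true | true = ⇔ᵇ-sound e

  hasMove-move : ∀ {s t} → Move s t → hasMove s ≡ true
  hasMove-move {s} m with hasMove s in h
  ... | true  = refl
  ... | false with () ← anyMove-false (λ _ → true) s h m

  survives-terminal : ∀ p s → (∀ t → ¬ Move s t) → survives p s ≡ nonempty s
  survives-terminal p s stuck = trans (survives-equation p s) (by p)
    where
    no-move : hasMove s ≡ false
    no-move with hasMove s in h
    ... | false = refl
    ... | true with t , m , _ ← anyMove-true (λ _ → true) s h with () ← stuck t m
    by : ∀ p → minimax p s ≡ nonempty s
    by Max rewrite no-move = refl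
    by Min rewrite no-move = refl

  survives-Max : ∀ {s t} → Move s t → survives Max s ≡ allMoves (survives Min) s
  survives-Max {s} m =
    trans (survives-equation Max s) (cong (λ h → if h then allMoves (survives Min) s else nonempty s) (hasMove-move m))

  survives-Min : ∀ {s t} → Move s t → survives Min s ≡ anyMove (survives Max) s
  survives-Min {s} m =
    trans (survives-equation Min s) (cong (λ h → if h then anyMove (survives Max) s else nonempty s) (hasMove-move m))

  survives-potential : ∀ p s → survives p s ≡ true → 1 ≤ potential s
  survives-potential Max (suc a , b , c) _ = s≤s z≤n
  survives-potential Min (suc a , b , c) _ = s≤s z≤n
  survives-potential p (0 , suc b , c) _ = s≤s z≤n
  survives-potential p (0 , 0 , suc c) _ = s≤s z≤n

open AbstractGame

true≢false : true ≢ false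
true≢false ()

-- Graphs of maximum degree two, i.e. disjoint unions of paths and cycles.
-- These are exactly the claw-free graphs, so they are the positions of the game.
module DegreeTwo {n : ℕ} where

  deg : Graph n → Fin n → ℕ
  deg G v = count (G v)

  MaxDeg2 : Graph n → Set
  MaxDeg2 G = (∀ u v → G u v ≡ G v u) × (∀ v → G v v ≡ false) × (∀ v → deg G v ≤ 2)

  module AddEdge (G : Graph n) (i j : Fin n) where

    G' : Graph n
    G' = addEdge G i j

    row-off : ∀ x → x ≢ i → x ≢ j → ∀ y → G' x y ≡ G x y
    row-off x x≢i x≢j y rewrite dec-false (x ≟ i) x≢i | dec-false (x ≟ j) x≢j = ∨-identityʳ (G x y)

    row-i : i ≢ j → ∀ y → G' i y ≡ G i y ∨ does (y ≟ j)
    row-i i≢j y rewrite dec-true (i ≟ i) refl | dec-false (i ≟ j) i≢j = cong (G i y ∨_) (∨-identityʳ _)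

    row-j : i ≢ j → ∀ y → G' j y ≡ G j y ∨ does (y ≟ i)
    row-j i≢j y rewrite dec-true (j ≟ j) refl | dec-false (j ≟ i) (λ q → i≢j (sym q)) = refl

    row-i-off : i ≢ j → ∀ y → y ≢ j → G' i y ≡ G i y
    row-i-off i≢j y y≢j rewrite row-i i≢j y | dec-false (y ≟ j) y≢j = ∨-identityʳ _

    row-j-off : i ≢ j → ∀ y → y ≢ i → G' j y ≡ G j y
    row-j-off i≢j y y≢i rewrite row-j i≢j y | dec-false (y ≟ i) y≢i = ∨-identityʳ _

    edge-ij : i ≢ j → G' i j ≡ true
    edge-ij i≢j rewrite row-i i≢j j | dec-true (j ≟ j) refl = ∨-zeroʳ (G i j)

    edge-ji : i ≢ j → G' j i ≡ true
    edge-ji i≢j rewrite row-j i≢j i | dec-true (i ≟ i) refl = ∨-zeroʳ (G j i)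

    deg-off : ∀ x → x ≢ i → x ≢ j → deg G' x ≡ deg G x
    deg-off x x≢i x≢j = count-cong (G' x) (G x) (row-off x x≢i x≢j)

    deg-new : ∀ x y → G' x y ≡ true → G x y ≡ false → (∀ z → z ≢ y → G' x z ≡ G x z) →
      deg G' x ≡ suc (deg G x)
    deg-new x y new old same = sym (begin
      1 + deg G x                            ≡⟨ +-comm 1 (deg G x) ⟩
      deg G x + 1                            ≡⟨ cong (λ b → deg G x + indicator b) new ⟨
      deg G x + indicator (G' x y)           ≡⟨ count-exchange (G x) (G' x) y (λ z z≢y → sym (same z z≢y)) ⟩
      deg G' x + indicator (G x y)           ≡⟨ cong (λ b → deg G' x + indicator b) old ⟩
      deg G' x + 0                           ≡⟨ +-identityʳ _ ⟩
      deg G' x                               ∎)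
      where open ≡-Reasoning

    deg-i : i ≢ j → G i j ≡ false → deg G' i ≡ suc (deg G i)
    deg-i i≢j gij = deg-new i j (edge-ij i≢j) gij (row-i-off i≢j)

    deg-j : i ≢ j → G j i ≡ false → deg G' j ≡ suc (deg G j)
    deg-j i≢j gji = deg-new j i (edge-ji i≢j) gji (row-j-off i≢j)

    loopless : (∀ v → G v v ≡ false) → i ≢ j → ∀ v → G' v v ≡ false
    loopless irr i≢j v with v ≟ i | v ≟ j
    ... | yes refl | yes v≡j = ⊥-elim (i≢j v≡j)
    ... | yes refl | no _    = trans (∨-identityʳ _) (irr v)
    ... | no _     | yes refl = trans (∨-identityʳ _) (irr v)
    ... | no _     | no _    = trans (∨-identityʳ _) (irr v)

    maxDeg2 : MaxDeg2 G → i ≢ j → G i j ≡ false → deg G i ≤ 1 → deg G j ≤ 1 → MaxDeg2 G'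
    maxDeg2 (sym-G , irr , deg≤2) i≢j gij di dj = sym-G' , loopless irr i≢j , deg≤2'
      where
      sym-G' : ∀ u v → G' u v ≡ G' v u
      sym-G' u v = cong₂ _∨_ (sym-G u v)
        (trans (∨-comm (does (u ≟ i) ∧ does (v ≟ j)) (does (u ≟ j) ∧ does (v ≟ i))) (cong₂ _∨_ (∧-comm (does (u ≟ j)) (does (v ≟ i))) (∧-comm (does (u ≟ i)) (does (v ≟ j)))))
      deg≤2' : ∀ v → deg G' v ≤ 2
      deg≤2' v = bound v (v ≟ i) (v ≟ j)
        where
        bound : ∀ v → Dec (v ≡ i) → Dec (v ≡ j) → deg G' v ≤ 2
        bound v (yes refl) _        = subst (_≤ 2) (sym (deg-i i≢j gij)) (s≤s di)
        bound v (no _)     (yes refl) = subst (_≤ 2) (sym (deg-j i≢j (trans (sym-G j i) gij))) (s≤s dj)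
        bound v (no v≢i)   (no v≢j)   = subst (_≤ 2) (sym (deg-off v v≢i v≢j)) (deg≤2 v)

  noClaw : (H : Graph n) → (∀ v → deg H v ≤ 2) → ¬ ContainsClaw H
  noClaw H deg≤2 (v , a , b , c , _ , _ , _ , a≢b , a≢c , b≢c , va , vb , vc)
    with s≤s (s≤s ()) ← ≤-trans (count-≥ (H v) (a ∷ b ∷ c ∷ []) ((a≢b , a≢c , tt) , (b≢c , tt) , tt , tt) (va ∷ vb ∷ vc ∷ [])) (deg≤2 v)

  claw : (H : Graph n) → (∀ v → H v v ≡ false) → ∀ v → 3 ≤ deg H v → ContainsClaw H
  claw H irr v 3≤deg with count-witness (H v) [] (≤-trans (s≤s z≤n) 3≤deg)
  ... | a , _ , va with count-witness (H v) (a ∷ []) (≤-trans (s≤s (s≤s z≤n)) 3≤deg)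
  ... | b , (b≢a , _) , vb with count-witness (H v) (b ∷ a ∷ []) 3≤deg
  ... | c , (c≢b , c≢a , _) , vc =
    v , a , b , c , not-v va , not-v vb , not-v vc ,
    (λ q → b≢a (sym q)) , (λ q → c≢a (sym q)) , (λ q → c≢b (sym q)) , va , vb , vc
    where
    not-v : ∀ {x} → H v x ≡ true → v ≢ x
    not-v vx refl = true≢false (trans (sym vx) (irr v))

  -- The type is read off from the
  -- degree and the number of neighbours that are leaves.
  isLeaf : Graph n → Fin n → Bool
  isLeaf G v = deg G v ≡ᵇ 1

  leafNeighbours : Graph n → Fin n → ℕ
  leafNeighbours G v = count (λ u → G v u ∧ isLeaf G u)

  -- (isolated? , end of a single edge? , end of a longer path?)
  TypeBits : Set
  TypeBits = Bool × Bool × Bool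

  isolatedBit edgeEndBit pathEndBit : TypeBits → Bool
  isolatedBit (z , _ , _) = z
  edgeEndBit  (_ , k , _) = k
  pathEndBit  (_ , _ , l) = l

  bitsOf : ℕ → ℕ → TypeBits
  bitsOf d l = (d ≡ᵇ 0) , ((d ≡ᵇ 1) ∧ (l ≡ᵇ 1)) , ((d ≡ᵇ 1) ∧ (l ≡ᵇ 0))

  typeBits : Graph n → Fin n → TypeBits
  typeBits G v = bitsOf (deg G v) (leafNeighbours G v)

  data VertexType (G : Graph n) (v : Fin n) : Set where
    isolated : deg G v ≡ 0 → VertexType G v
    edgeEnd  : ∀ p → deg G v ≡ 1 → G v p ≡ true → deg G p ≡ 1 → VertexType G v
    pathEnd  : ∀ p → deg G v ≡ 1 → G v p ≡ true → deg G p ≡ 2 → VertexType G v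
    inner    : deg G v ≡ 2 → VertexType G v

  isolatedBits edgeEndBits pathEndBits innerBits : TypeBits
  isolatedBits = true  , false , false
  edgeEndBits  = false , true  , false
  pathEndBits  = false , false , true
  innerBits    = false , false , false

  bits : ∀ {G v} → VertexType G v → TypeBits
  bits (isolated _)    = isolatedBits
  bits (edgeEnd _ _ _ _) = edgeEndBits
  bits (pathEnd _ _ _ _) = pathEndBits
  bits (inner _)       = innerBits

  leaf-neighbour : ∀ (G : Graph n) v → deg G v ≡ 1 → ∀ x y → G v x ≡ true → G v y ≡ true → x ≡ y
  leaf-neighbour G v = count-one (G v)

  leafNeighbours-leaf : ∀ (G : Graph n) v p → deg G v ≡ 1 → G v p ≡ true →
    leafNeighbours G v ≡ indicator (isLeaf G p)
  leafNeighbours-leaf G v p dv vp =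
    trans (count-only (λ u → G v u ∧ isLeaf G u) p (λ u h → leaf-neighbour G v dv u p (∧-true h) vp))
          (cong (λ b → indicator (b ∧ isLeaf G p)) vp)
    where
    ∧-true : ∀ {x y} → x ∧ y ≡ true → x ≡ true
    ∧-true {true} _ = refl

  typeBits-correct : ∀ (G : Graph n) v → (t : VertexType G v) → typeBits G v ≡ bits t
  typeBits-correct G v (isolated dv) rewrite dv = refl
  typeBits-correct G v (edgeEnd p dv vp dp) rewrite leafNeighbours-leaf G v p dv vp | dv | dp = refl
  typeBits-correct G v (pathEnd p dv vp dp) rewrite leafNeighbours-leaf G v p dv vp | dv | dp = refl
  typeBits-correct G v (inner dv) rewrite dv = refl

  classify : ∀ (G : Graph n) → MaxDeg2 G → ∀ v → VertexType G v
  classify G (sym-G , _ , deg≤2) v = byDegree (deg G v) refl (deg≤2 v)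
    where
    byDegree : ∀ k → deg G v ≡ k → k ≤ 2 → VertexType G v
    byDegree 0 dv _ = isolated dv
    byDegree 1 dv _ with count-witness (G v) [] (subst (1 ≤_) (sym dv) (s≤s z≤n))
    ... | p , _ , vp = byPartner (deg G p) refl (deg≤2 p)
      where
      byPartner : ∀ m → deg G p ≡ m → m ≤ 2 → VertexType G v
      byPartner 0 dp _ = ⊥-elim (true≢false (trans (sym (trans (sym-G p v) vp)) (count-zero (G p) dp v)))
      byPartner 1 dp _ = edgeEnd p dv vp dp
      byPartner 2 dp _ = pathEnd p dv vp dp
      byPartner (suc (suc (suc _))) _ (s≤s (s≤s ()))
    byDegree 2 dv _ = inner dv
    byDegree (suc (suc (suc _))) _ (s≤s (s≤s ()))

  module Untouched (G : Graph n) (i j : Fin n) where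
    open AddEdge G i j

    type-unchanged : ∀ v → v ≢ i → v ≢ j → (G v i ≡ false × G v j ≡ false) ⊎ isLeaf G v ≡ false →
      typeBits G v ≡ typeBits G' v
    type-unchanged v v≢i v≢j (inj₁ (vi , vj)) =
      cong₂ bitsOf (sym (deg-off v v≢i v≢j)) (count-cong _ _ (λ u → same-leaf u (G v u) refl))
      where
      same-leaf : ∀ u b → G v u ≡ b → (G v u ∧ isLeaf G u) ≡ (G' v u ∧ isLeaf G' u)
      same-leaf u false vu rewrite row-off v v≢i v≢j u | vu = refl
      same-leaf u true  vu rewrite row-off v v≢i v≢j u | vu =
        cong (_≡ᵇ 1) (sym (deg-off u (λ { refl → true≢false (trans (sym vu) vi) })
                                     (λ { refl → true≢false (trans (sym vu) vj) })))
    type-unchanged v v≢i v≢j (inj₂ not-leaf) =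
      trans (nonleaf (deg G v) (leafNeighbours G v) (leafNeighbours G' v) not-leaf)
            (cong (λ d → bitsOf d (leafNeighbours G' v)) (sym (deg-off v v≢i v≢j)))
      where
      nonleaf : ∀ d l l' → (d ≡ᵇ 1) ≡ false → bitsOf d l ≡ bitsOf d l'
      nonleaf d l l' nl rewrite nl = refl

  -- For an endpoint i of type t, the vertices v with Unaffected t v are
  -- those whose type cannot change when i gains an edge: everything except
  -- the partner of an edge end.  An inner vertex never gains an edge.
  Unaffected : ∀ {G i} → VertexType G i → Fin n → Set
  Unaffected (edgeEnd p _ _ _) v = v ≢ p
  Unaffected (inner _)         v = ⊥
  Unaffected _                 v = ⊤

  unaffected : ∀ (G : Graph n) → MaxDeg2 G → ∀ i → (t : VertexType G i) → ∀ v → Unaffected t v →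
    G v i ≡ false ⊎ isLeaf G v ≡ false
  unaffected G (sym-G , _ , _) i (isolated di) v _ = inj₁ (trans (sym-G v i) (count-zero (G i) di v))
  unaffected G (sym-G , _ , _) i (edgeEnd p di ip _) v v≢p with G i v in iv
  ... | false = inj₁ (trans (sym-G v i) iv)
  ... | true  = ⊥-elim (v≢p (leaf-neighbour G i di v p iv ip))
  unaffected G (sym-G , _ , _) i (pathEnd p di ip dp) v _ with G i v in iv
  ... | false = inj₁ (trans (sym-G v i) iv)
  ... | true rewrite leaf-neighbour G i di v p iv ip | dp = inj₂ refl

  both-unaffected : ∀ {G : Graph n} {v i j} → G v i ≡ false ⊎ isLeaf G v ≡ false → G v j ≡ false ⊎ isLeaf G v ≡ false →
    (G v i ≡ false × G v j ≡ false) ⊎ isLeaf G v ≡ false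
  both-unaffected (inj₁ vi) (inj₁ vj) = inj₁ (vi , vj)
  both-unaffected (inj₂ nl) _         = inj₂ nl
  both-unaffected (inj₁ _)  (inj₂ nl) = inj₂ nl

module Halving where

  Even : ℕ → Set
  Even m = ∃ λ k → m ≡ k + k

  even+2 : ∀ {m} → Even m → Even (suc (suc m))
  even+2 (k , refl) = suc k , cong suc (sym (+-suc k k))

  even-2 : ∀ {m} → Even (suc (suc m)) → Even m
  even-2 (suc k , e) = k , cong pred (trans (cong pred e) (+-suc k k))

  half-positive : ∀ {m} → Even m → 1 ≤ m → ∃ λ c → ⌊ m /2⌋ ≡ suc c
  half-positive (suc k , refl) _ = k , sym (n≡⌊n+n/2⌋ (suc k))

open Halving

-- Profile arithmetic: ProfileMove k a a' e e' l l' says that the counts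
-- (a' , e' , l') of isolated vertices, edge ends and path ends after a move
-- are a profile obtained from (a , e , l) by a move of kind k.
module ProfileArithmetic where

  ProfileMove : Kind → ℕ → ℕ → ℕ → ℕ → ℕ → ℕ → Set
  ProfileMove k a a' e e' l l' = Even e' × Even l' ×
    Move (a , ⌊ e /2⌋ , ⌊ l /2⌋) (a' , ⌊ e' /2⌋ , ⌊ l' /2⌋) ×
    (a' , ⌊ e' /2⌋ , ⌊ l' /2⌋) ≡ after k (a , ⌊ e /2⌋ , ⌊ l /2⌋)

  private
    gain : ∀ {x y} c → x + c ≡ y + 0 → y ≡ c + x
    gain {x} {y} c eq = trans (sym (+-identityʳ y)) (trans (sym eq) (+-comm x c))

    loss : ∀ {x y} d → x + 0 ≡ y + d → x ≡ d + y
    loss d eq = gain d (sym eq)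

    same : ∀ {x y} c → x + c ≡ y + c → x ≡ y
    same {x} {y} c eq = +-cancelʳ-≡ c x y eq

  iso-iso : ∀ {a a' e e' l l'} → a' + 2 ≡ a + 0 → e' + 0 ≡ e + 2 → l' + 0 ≡ l + 0 →
    Even e → Even l → ProfileMove isoIso a a' e e' l l'
  iso-iso da de dl even-e even-l with gain 2 da | loss 2 de | same 0 dl
  ... | refl | refl | refl = even+2 even-e , even-l , isoIso , refl

  iso-edge : ∀ {a a' e e' l l'} → a' + 1 ≡ a + 0 → e' + 2 ≡ e + 0 → l' + 0 ≡ l + 2 →
    Even e → Even l → ProfileMove isoEdge a a' e e' l l'
  iso-edge da de dl even-e even-l with gain 1 da | gain 2 de | loss 2 dl
  ... | refl | refl | refl = even-2 even-e , even+2 even-l , isoEdge , refl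

  iso-path : ∀ {a a' e e' l l'} → a' + 1 ≡ a + 0 → e' + 0 ≡ e + 0 → l' + 1 ≡ l + 1 →
    Even e → Even l → 1 ≤ l → ProfileMove isoPath a a' e e' l l'
  iso-path da de dl even-e even-l l≥1 with gain 1 da | same 0 de | same 1 dl | half-positive even-l l≥1
  ... | refl | refl | refl | c , half rewrite half = even-e , even-l , isoPath , refl

  edge-edge : ∀ {a a' e e' l l'} → a' + 0 ≡ a + 0 → e' + 4 ≡ e + 0 → l' + 0 ≡ l + 2 →
    Even e → Even l → ProfileMove edgeEdge a a' e e' l l'
  edge-edge da de dl even-e even-l with same 0 da | gain 4 de | loss 2 dl
  ... | refl | refl | refl = even-2 (even-2 even-e) , even+2 even-l , edgeEdge , refl

  edge-path : ∀ {a a' e e' l l'} → a' + 0 ≡ a + 0 → e' + 2 ≡ e + 0 → l' + 1 ≡ l + 1 →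
    Even e → Even l → 1 ≤ l → ProfileMove edgePath a a' e e' l l'
  edge-path da de dl even-e even-l l≥1 with same 0 da | gain 2 de | same 1 dl | half-positive even-l l≥1
  ... | refl | refl | refl | c , half rewrite half = even-2 even-e , even-l , edgePath , refl

  path-path : ∀ {a a' e e' l l'} → a' + 0 ≡ a + 0 → e' + 0 ≡ e + 0 → l' + 2 ≡ l + 0 →
    Even e → Even l → ProfileMove pathPath a a' e e' l l'
  path-path da de dl even-e even-l with same 0 da | same 0 de | gain 2 dl
  ... | refl | refl | refl = even-e , even-2 even-l , pathPath , refl

module ProfileOf {n : ℕ} where
  open DegreeTwo {n}

  countType : (TypeBits → Bool) → Graph n → ℕ
  countType sel G = count (λ v → sel (typeBits G v))

  -- the ends of single edges and of long paths come in pairs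
  Invariant : Graph n → Set
  Invariant G = MaxDeg2 G × Even (countType edgeEndBit G) × Even (countType pathEndBit G)

  profile : Graph n → Profile
  profile G = countType isolatedBit G , ⌊ countType edgeEndBit G /2⌋ , ⌊ countType pathEndBit G /2⌋

  module Pointwise (H H' : Graph n) (same : ∀ u v → H u v ≡ H' u v) where
    deg-same : ∀ v → deg H v ≡ deg H' v
    deg-same v = count-cong (H v) (H' v) (same v)

    typeBits-same : ∀ v → typeBits H v ≡ typeBits H' v
    typeBits-same v = cong₂ bitsOf (deg-same v)
      (count-cong _ _ (λ u → cong₂ _∧_ (same v u) (cong (_≡ᵇ 1) (deg-same u))))

    countType-same : ∀ sel → countType sel H ≡ countType sel H'
    countType-same sel = count-cong _ _ (λ v → cong sel (typeBits-same v))

    profile-same : profile H ≡ profile H'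
    profile-same = cong₂ _,_ (countType-same isolatedBit)
      (cong₂ _,_ (cong ⌊_/2⌋ (countType-same edgeEndBit)) (cong ⌊_/2⌋ (countType-same pathEndBit)))

    invariant-same : Invariant H → Invariant H'
    invariant-same ((sym-H , irr , deg≤2) , even-e , even-l) =
      ((λ u v → trans (sym (same u v)) (trans (sym-H u v) (same v u))) ,
       (λ v → trans (sym (same v v)) (irr v)) ,
       (λ v → subst (_≤ 2) (deg-same v) (deg≤2 v))) ,
      subst Even (countType-same edgeEndBit) even-e , subst Even (countType-same pathEndBit) even-l

  addEdge-comm : ∀ (G : Graph n) i j u v → addEdge G j i u v ≡ addEdge G i j u v
  addEdge-comm G i j u v = cong (G u v ∨_) (∨-comm (does (u ≟ j) ∧ does (v ≟ i)) (does (u ≟ i) ∧ does (v ≟ j)))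

  -- The effect of adding a new edge {i , j} between two vertices of degree
  -- at most one: only i, j and possibly their partners change type.
  module EdgeEffect (G : Graph n) (md : MaxDeg2 G) (i j : Fin n) (i≢j : i ≢ j) (gij : G i j ≡ false) where
    open AddEdge G i j
    open Untouched G i j

    sym-G = proj₁ md
    irr   = proj₁ (proj₂ md)

    gji : G j i ≡ false
    gji = trans (sym-G j i) gij

    record Touched : Set where
      constructor touched
      field
        vertex : Fin n
        old    : VertexType G vertex
        new    : VertexType G' vertex

    vertices : List Touched → List (Fin n)
    vertices = map Touched.vertex

    countOld countNew : (TypeBits → Bool) → List Touched → ℕ
    countOld sel []                   = 0
    countOld sel (touched _ t _ ∷ ts) = indicator (sel (bits t)) + countOld sel ts
    countNew sel []                   = 0
    countNew sel (touched _ _ t ∷ ts) = indicator (sel (bits t)) + countNew sel ts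

    Change : ℕ → ℕ → ℕ → ℕ → ℕ → ℕ → Set
    Change a a' e e' l l' = MaxDeg2 G' ×
      (countType isolatedBit G' + a ≡ countType isolatedBit G + a') ×
      (countType edgeEndBit  G' + e ≡ countType edgeEndBit  G + e') ×
      (countType pathEndBit  G' + l ≡ countType pathEndBit  G + l')

    change : ∀ ts → Distinct (vertices ts) → (∀ v → NotIn v (vertices ts) → typeBits G v ≡ typeBits G' v) →
      MaxDeg2 G' →
      Change (countOld isolatedBit ts) (countNew isolatedBit ts) (countOld edgeEndBit ts)
             (countNew edgeEndBit ts) (countOld pathEndBit ts) (countNew pathEndBit ts)
    change ts distinct untouched md' = md' , for isolatedBit , for edgeEndBit , for pathEndBit
      where
      along-old : ∀ sel ts → countAlong (λ v → sel (typeBits G v)) (vertices ts) ≡ countOld sel ts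
      along-old sel []                   = refl
      along-old sel (touched v t _ ∷ ts) =
        cong₂ _+_ (cong (λ b → indicator (sel b)) (typeBits-correct G v t)) (along-old sel ts)
      along-new : ∀ sel ts → countAlong (λ v → sel (typeBits G' v)) (vertices ts) ≡ countNew sel ts
      along-new sel []                   = refl
      along-new sel (touched v _ t ∷ ts) =
        cong₂ _+_ (cong (λ b → indicator (sel b)) (typeBits-correct G' v t)) (along-new sel ts)
      for : ∀ sel → countType sel G' + countOld sel ts ≡ countType sel G + countNew sel ts
      for sel = subst₂' (along-old sel ts) (along-new sel ts)
        (count-along (λ v → sel (typeBits G v)) (λ v → sel (typeBits G' v)) (vertices ts) distinct
                     (λ v v∉ → cong sel (untouched v v∉)))
        where
        subst₂' : ∀ {x x' y y'} → x ≡ x' → y ≡ y' →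
          countType sel G' + x ≡ countType sel G + y → countType sel G' + x' ≡ countType sel G + y'
        subst₂' refl refl h = h

    untouched : (ti : VertexType G i) (tj : VertexType G j) → ∀ v → v ≢ i → v ≢ j →
      Unaffected ti v → Unaffected tj v → typeBits G v ≡ typeBits G' v
    untouched ti tj v v≢i v≢j ui uj =
      type-unchanged v v≢i v≢j (both-unaffected {G = G} (unaffected G md i ti v ui) (unaffected G md j tj v uj))

    deg-i′ : ∀ {d} → deg G i ≡ d → deg G' i ≡ suc d
    deg-i′ di = trans (deg-i i≢j gij) (cong suc di)

    deg-j′ : ∀ {d} → deg G j ≡ d → deg G' j ≡ suc d
    deg-j′ dj = trans (deg-j i≢j gji) (cong suc dj)

    ≤1 : ∀ {d} → d ≤ 1 → ∀ {m} → m ≡ d → m ≤ 1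
    ≤1 d≤1 refl = d≤1

    maxDeg2′ : ∀ {di dj} → deg G i ≡ di → deg G j ≡ dj → di ≤ 1 → dj ≤ 1 → MaxDeg2 G'
    maxDeg2′ di dj di≤1 dj≤1 = maxDeg2 md i≢j gij (≤1 di≤1 di) (≤1 dj≤1 dj)

    adjacent-distinct : ∀ {x p} → G x p ≡ true → x ≢ p
    adjacent-distinct {x} xp refl = true≢false (trans (sym xp) (irr x))

    partner : ∀ {x p} → p ≢ i → p ≢ j → deg G p ≡ 1 → G x p ≡ true → deg G' x ≡ 2 → VertexType G' p
    partner {x} {p} p≢i p≢j dp xp dx =
      pathEnd x (trans (deg-off p p≢i p≢j) dp) (trans (row-off p p≢i p≢j x) (trans (sym-G p x) xp)) dx

    not-adjacent : ∀ {z x y} → G z y ≡ true → G z x ≡ false → x ≢ y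
    not-adjacent zy zx refl = true≢false (trans (sym zy) zx)

    iso-iso : deg G i ≡ 0 → deg G j ≡ 0 → Change 2 0 0 2 0 0
    iso-iso di dj = change
      (touched i (isolated di) (edgeEnd j (deg-i′ di) (edge-ij i≢j) (deg-j′ dj)) ∷
       touched j (isolated dj) (edgeEnd i (deg-j′ dj) (edge-ji i≢j) (deg-i′ di)) ∷ [])
      ((i≢j , tt) , tt , tt)
      (λ { v (v≢i , v≢j , _) → untouched (isolated di) (isolated dj) v v≢i v≢j tt tt })
      (maxDeg2′ di dj z≤n z≤n)

    iso-edge : deg G i ≡ 0 → ∀ q → deg G j ≡ 1 → G j q ≡ true → deg G q ≡ 1 → Change 1 0 2 0 0 2
    iso-edge di q dj jq dq = change
      (touched i (isolated di) (pathEnd j (deg-i′ di) (edge-ij i≢j) (deg-j′ dj)) ∷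
       touched j (edgeEnd q dj jq dq) (inner (deg-j′ dj)) ∷
       touched q (edgeEnd j dq (trans (sym-G q j) jq) dj)
                 (partner (λ q≡i → i≢q (sym q≡i)) (λ q≡j → j≢q (sym q≡j)) dq jq (deg-j′ dj)) ∷ [])
      ((i≢j , i≢q , tt) , (j≢q , tt) , tt , tt)
      (λ { v (v≢i , v≢j , v≢q , _) → untouched (isolated di) (edgeEnd q dj jq dq) v v≢i v≢j tt v≢q })
      (maxDeg2′ di dj z≤n (s≤s z≤n))
      where
      i≢q = not-adjacent jq gji
      j≢q = adjacent-distinct jq

    iso-path : deg G i ≡ 0 → ∀ q → deg G j ≡ 1 → G j q ≡ true → deg G q ≡ 2 → Change 1 0 0 0 1 1
    iso-path di q dj jq dq = change
      (touched i (isolated di) (pathEnd j (deg-i′ di) (edge-ij i≢j) (deg-j′ dj)) ∷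
       touched j (pathEnd q dj jq dq) (inner (deg-j′ dj)) ∷ [])
      ((i≢j , tt) , tt , tt)
      (λ { v (v≢i , v≢j , _) → untouched (isolated di) (pathEnd q dj jq dq) v v≢i v≢j tt tt })
      (maxDeg2′ di dj z≤n (s≤s z≤n))

    edge-edge : ∀ p → deg G i ≡ 1 → G i p ≡ true → deg G p ≡ 1 →
                ∀ q → deg G j ≡ 1 → G j q ≡ true → deg G q ≡ 1 → Change 0 0 4 0 0 2
    edge-edge p di ip dp q dj jq dq = change
      (touched i (edgeEnd p di ip dp) (inner (deg-i′ di)) ∷
       touched j (edgeEnd q dj jq dq) (inner (deg-j′ dj)) ∷
       touched p (edgeEnd i dp (trans (sym-G p i) ip) di)
                 (partner (λ p≡i → i≢p (sym p≡i)) (λ p≡j → j≢p (sym p≡j)) dp ip (deg-i′ di)) ∷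
       touched q (edgeEnd j dq (trans (sym-G q j) jq) dj)
                 (partner (λ q≡i → i≢q (sym q≡i)) (λ q≡j → j≢q (sym q≡j)) dq jq (deg-j′ dj)) ∷ [])
      ((i≢j , i≢p , i≢q , tt) , (j≢p , j≢q , tt) , (p≢q , tt) , tt , tt)
      (λ { v (v≢i , v≢j , v≢p , v≢q , _) →
             untouched (edgeEnd p di ip dp) (edgeEnd q dj jq dq) v v≢i v≢j v≢p v≢q })
      (maxDeg2′ di dj (s≤s z≤n) (s≤s z≤n))
      where
      i≢p = adjacent-distinct ip
      j≢q = adjacent-distinct jq
      i≢q = not-adjacent jq gji
      j≢p = not-adjacent ip gij
      p≢q : p ≢ q
      p≢q refl = i≢j (leaf-neighbour G p dp i j (trans (sym-G p i) ip) (trans (sym-G p j) jq))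

    edge-path : ∀ p → deg G i ≡ 1 → G i p ≡ true → deg G p ≡ 1 →
                ∀ q → deg G j ≡ 1 → G j q ≡ true → deg G q ≡ 2 → Change 0 0 2 0 1 1
    edge-path p di ip dp q dj jq dq = change
      (touched i (edgeEnd p di ip dp) (inner (deg-i′ di)) ∷
       touched j (pathEnd q dj jq dq) (inner (deg-j′ dj)) ∷
       touched p (edgeEnd i dp (trans (sym-G p i) ip) di)
                 (partner (λ p≡i → i≢p (sym p≡i)) (λ p≡j → j≢p (sym p≡j)) dp ip (deg-i′ di)) ∷ [])
      ((i≢j , i≢p , tt) , (j≢p , tt) , tt , tt)
      (λ { v (v≢i , v≢j , v≢p , _) → untouched (edgeEnd p di ip dp) (pathEnd q dj jq dq) v v≢i v≢j v≢p tt })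
      (maxDeg2′ di dj (s≤s z≤n) (s≤s z≤n))
      where
      i≢p = adjacent-distinct ip
      j≢p = not-adjacent ip gij

    path-path : ∀ p → deg G i ≡ 1 → G i p ≡ true → deg G p ≡ 2 →
                ∀ q → deg G j ≡ 1 → G j q ≡ true → deg G q ≡ 2 → Change 0 0 0 0 2 0
    path-path p di ip dp q dj jq dq = change
      (touched i (pathEnd p di ip dp) (inner (deg-i′ di)) ∷
       touched j (pathEnd q dj jq dq) (inner (deg-j′ dj)) ∷ [])
      ((i≢j , tt) , tt , tt)
      (λ { v (v≢i , v≢j , _) → untouched (pathEnd p di ip dp) (pathEnd q dj jq dq) v v≢i v≢j tt tt })
      (maxDeg2′ di dj (s≤s z≤n) (s≤s z≤n))

  Step : Kind → (G G' : Graph n) → Set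
  Step k G G' = Invariant G' × Move (profile G) (profile G') × profile G' ≡ after k (profile G)

  module Steps (G : Graph n) (inv : Invariant G) (i j : Fin n) (i≢j : i ≢ j) (gij : G i j ≡ false) where
    open EdgeEffect G (proj₁ inv) i j i≢j gij
    open AddEdge G i j using (G')
    module PA = ProfileArithmetic

    even-e = proj₁ (proj₂ inv)
    even-l = proj₂ (proj₂ inv)

    glue : ∀ {k a a' e e' l l'} → Change a a' e e' l l' →
      (countType isolatedBit G' + a ≡ countType isolatedBit G + a' →
       countType edgeEndBit  G' + e ≡ countType edgeEndBit  G + e' →
       countType pathEndBit  G' + l ≡ countType pathEndBit  G + l' →
       PA.ProfileMove k (countType isolatedBit G) (countType isolatedBit G') (countType edgeEndBit G)
                        (countType edgeEndBit G') (countType pathEndBit G) (countType pathEndBit G')) →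
      Step k G G'
    glue (md' , da , de , dl) arithmetic with arithmetic da de dl
    ... | even-e' , even-l' , move , moved = (md' , even-e' , even-l') , move , moved

    some-path-end : ∀ q → deg G j ≡ 1 → G j q ≡ true → deg G q ≡ 2 → 1 ≤ countType pathEndBit G
    some-path-end q dj jq dq =
      count-≥ _ (j ∷ []) (tt , tt) (cong pathEndBit (typeBits-correct G j (pathEnd q dj jq dq)) ∷ [])

    step-iso-iso : deg G i ≡ 0 → deg G j ≡ 0 → Step isoIso G G'
    step-iso-iso di dj = glue {k = isoIso} (iso-iso di dj) (λ da de dl → PA.iso-iso da de dl even-e even-l)

    step-iso-edge : deg G i ≡ 0 → ∀ q → deg G j ≡ 1 → G j q ≡ true → deg G q ≡ 1 → Step isoEdge G G'
    step-iso-edge di q dj jq dq = glue {k = isoEdge} (iso-edge di q dj jq dq) (λ da de dl → PA.iso-edge da de dl even-e even-l)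

    step-iso-path : deg G i ≡ 0 → ∀ q → deg G j ≡ 1 → G j q ≡ true → deg G q ≡ 2 → Step isoPath G G'
    step-iso-path di q dj jq dq = glue {k = isoPath} (iso-path di q dj jq dq)
      (λ da de dl → PA.iso-path da de dl even-e even-l (some-path-end q dj jq dq))

    step-edge-edge : ∀ p → deg G i ≡ 1 → G i p ≡ true → deg G p ≡ 1 →
                     ∀ q → deg G j ≡ 1 → G j q ≡ true → deg G q ≡ 1 → Step edgeEdge G G'
    step-edge-edge p di ip dp q dj jq dq =
      glue {k = edgeEdge} (edge-edge p di ip dp q dj jq dq) (λ da de dl → PA.edge-edge da de dl even-e even-l)

    step-edge-path : ∀ p → deg G i ≡ 1 → G i p ≡ true → deg G p ≡ 1 →
                     ∀ q → deg G j ≡ 1 → G j q ≡ true → deg G q ≡ 2 → Step edgePath G G'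
    step-edge-path p di ip dp q dj jq dq = glue {k = edgePath} (edge-path p di ip dp q dj jq dq)
      (λ da de dl → PA.edge-path da de dl even-e even-l (some-path-end q dj jq dq))

    step-path-path : ∀ p → deg G i ≡ 1 → G i p ≡ true → deg G p ≡ 2 →
                     ∀ q → deg G j ≡ 1 → G j q ≡ true → deg G q ≡ 2 → Step pathPath G G'
    step-path-path p di ip dp q dj jq dq =
      glue {k = pathPath} (path-path p di ip dp q dj jq dq) (λ da de dl → PA.path-path da de dl even-e even-l)

  legal-step : ∀ G → Invariant G → ∀ i j → i ≢ j → G i j ≡ false → deg G i ≤ 1 → deg G j ≤ 1 →
    Invariant (addEdge G i j) × Move (profile G) (profile (addEdge G i j))
  legal-step G inv i j i≢j gij di≤1 dj≤1 = by-types (classify G md i) (classify G md j)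
    where
    md = proj₁ inv
    module A = Steps G inv i j i≢j gij
    module B = Steps G inv j i (λ q → i≢j (sym q)) (trans (proj₁ md j i) gij)
    Goal = Invariant (addEdge G i j) × Move (profile G) (profile (addEdge G i j))

    forget : ∀ k → Step k G (addEdge G i j) → Goal
    forget _ (inv' , move , _) = inv' , move

    swap : ∀ k → Step k G (addEdge G j i) → Goal
    swap _ (inv' , move , _) = invariant-same inv' , subst (Move (profile G)) profile-same move
      where open Pointwise (addEdge G j i) (addEdge G i j) (addEdge-comm G i j)

    not-inner : ∀ {d} → d ≡ 2 → d ≤ 1 → ∀ {A : Set} → A
    not-inner refl (s≤s ())

    by-types : VertexType G i → VertexType G j → Goal
    by-types (inner di) _ = not-inner di di≤1
    by-types _ (inner dj) = not-inner dj dj≤1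
    by-types (isolated di)       (isolated dj)       = forget isoIso (A.step-iso-iso di dj)
    by-types (isolated di)       (edgeEnd q dj jq dq) = forget isoEdge (A.step-iso-edge di q dj jq dq)
    by-types (isolated di)       (pathEnd q dj jq dq) = forget isoPath (A.step-iso-path di q dj jq dq)
    by-types (edgeEnd p di ip dp) (isolated dj)       = swap isoEdge (B.step-iso-edge dj p di ip dp)
    by-types (edgeEnd p di ip dp) (edgeEnd q dj jq dq) = forget edgeEdge (A.step-edge-edge p di ip dp q dj jq dq)
    by-types (edgeEnd p di ip dp) (pathEnd q dj jq dq) = forget edgePath (A.step-edge-path p di ip dp q dj jq dq)
    by-types (pathEnd p di ip dp) (isolated dj)       = swap isoPath (B.step-iso-path dj p di ip dp)
    by-types (pathEnd p di ip dp) (edgeEnd q dj jq dq) = swap edgePath (B.step-edge-path q dj jq dq p di ip dp)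
    by-types (pathEnd p di ip dp) (pathEnd q dj jq dq) = forget pathPath (A.step-path-path p di ip dp q dj jq dq)

  Realized : Graph n → Profile → Set
  Realized G t = ∃ λ i → ∃ λ j → i ≢ j × G i j ≡ false × deg G i ≤ 1 × deg G j ≤ 1 × profile (addEdge G i j) ≡ t

  half≥2 : ∀ x {b} → ⌊ x /2⌋ ≡ suc b → 2 ≤ x
  half≥2 (suc (suc x)) _ = s≤s (s≤s z≤n)

  half≥4 : ∀ x {b} → ⌊ x /2⌋ ≡ suc (suc b) → 4 ≤ x
  half≥4 (suc (suc x)) h = s≤s (s≤s (half≥2 x (cong pred h)))

  module Realize (G : Graph n) (inv : Invariant G) where
    md = proj₁ inv
    sym-G = proj₁ md
    module S = Steps G inv

    typed : ∀ v (sel : TypeBits → Bool) → sel (typeBits G v) ≡ true → ∃ λ (t : VertexType G v) → sel (bits t) ≡ true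
    typed v sel h = classify G md v , trans (sym (cong sel (typeBits-correct G v (classify G md v)))) h

    isolated-of : ∀ v → isolatedBit (typeBits G v) ≡ true → deg G v ≡ 0
    isolated-of v h with typed v isolatedBit h
    ... | isolated dv , _ = dv

    edgeEnd-of : ∀ v → edgeEndBit (typeBits G v) ≡ true → ∃ λ p → deg G v ≡ 1 × G v p ≡ true × deg G p ≡ 1
    edgeEnd-of v h with typed v edgeEndBit h
    ... | edgeEnd p dv vp dp , _ = p , dv , vp , dp

    pathEnd-of : ∀ v → pathEndBit (typeBits G v) ≡ true → ∃ λ p → deg G v ≡ 1 × G v p ≡ true × deg G p ≡ 2
    pathEnd-of v h with typed v pathEndBit h
    ... | pathEnd p dv vp dp , _ = p , dv , vp , dp

    ≤1 : ∀ {d} → d ≡ 0 ⊎ d ≡ 1 → d ≤ 1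
    ≤1 (inj₁ refl) = z≤n
    ≤1 (inj₂ refl) = s≤s z≤n

    degrees-differ : ∀ {x y} → deg G x ≡ 0 → deg G y ≡ 1 → x ≢ y
    degrees-differ dx dy refl with () ← trans (sym dx) dy

    two-isolated : ∀ {a b c} → profile G ≡ (suc (suc a) , b , c) → 2 ≤ countType isolatedBit G
    two-isolated e = subst (2 ≤_) (sym (cong proj₁ e)) (s≤s (s≤s z≤n))

    one-isolated : ∀ {a b c} → profile G ≡ (suc a , b , c) → 1 ≤ countType isolatedBit G
    one-isolated e = subst (1 ≤_) (sym (cong proj₁ e)) (s≤s z≤n)

    two-edge-ends : ∀ {a b c} → profile G ≡ (a , suc b , c) → 2 ≤ countType edgeEndBit G
    two-edge-ends e = half≥2 _ (cong (λ s → proj₁ (proj₂ s)) e)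

    four-edge-ends : ∀ {a b c} → profile G ≡ (a , suc (suc b) , c) → 4 ≤ countType edgeEndBit G
    four-edge-ends e = half≥4 _ (cong (λ s → proj₁ (proj₂ s)) e)

    two-path-ends : ∀ {a b c} → profile G ≡ (a , b , suc c) → 2 ≤ countType pathEndBit G
    two-path-ends e = half≥2 _ (cong (λ s → proj₂ (proj₂ s)) e)

    1≤ : ∀ {m} → 2 ≤ m → 1 ≤ m
    1≤ = ≤-trans (s≤s z≤n)

    realize : ∀ {s t} → Move s t → profile G ≡ s → Realized G t
    realize isoIso e
      with i , _ , iz ← count-witness _ [] (1≤ (two-isolated e))
      with j , (j≢i , _) , jz ← count-witness _ (i ∷ []) (two-isolated e) =
      i , j , i≢j , gij , ≤1 (inj₁ di) , ≤1 (inj₁ dj) ,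
      trans (proj₂ (proj₂ (S.step-iso-iso i j i≢j gij di dj))) (cong (after isoIso) e)
      where
      i≢j = λ q → j≢i (sym q)
      di = isolated-of i iz
      dj = isolated-of j jz
      gij = count-zero (G i) di j
    realize isoEdge e
      with i , _ , iz ← count-witness _ [] (one-isolated e)
         | j , _ , je ← count-witness _ [] (1≤ (two-edge-ends e))
      with q , dj , jq , dq ← edgeEnd-of j je =
      i , j , i≢j , gij , ≤1 (inj₁ di) , ≤1 (inj₂ dj) ,
      trans (proj₂ (proj₂ (S.step-iso-edge i j i≢j gij di q dj jq dq))) (cong (after isoEdge) e)
      where
      di = isolated-of i iz
      i≢j = degrees-differ di dj
      gij = count-zero (G i) di j
    realize isoPath e
      with i , _ , iz ← count-witness _ [] (one-isolated e)
         | j , _ , jl ← count-witness _ [] (1≤ (two-path-ends e))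
      with q , dj , jq , dq ← pathEnd-of j jl =
      i , j , i≢j , gij , ≤1 (inj₁ di) , ≤1 (inj₂ dj) ,
      trans (proj₂ (proj₂ (S.step-iso-path i j i≢j gij di q dj jq dq))) (cong (after isoPath) e)
      where
      di = isolated-of i iz
      i≢j = degrees-differ di dj
      gij = count-zero (G i) di j
    realize edgeEdge e
      with i , _ , ie ← count-witness _ [] (≤-trans (s≤s z≤n) (four-edge-ends e))
      with p , di , ip , dp ← edgeEnd-of i ie
      with j , (j≢p , j≢i , _) , je ← count-witness _ (p ∷ i ∷ []) (≤-trans (s≤s (s≤s (s≤s z≤n))) (four-edge-ends e))
      with q , dj , jq , dq ← edgeEnd-of j je =
      i , j , i≢j , gij , ≤1 (inj₂ di) , ≤1 (inj₂ dj) ,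
      trans (proj₂ (proj₂ (S.step-edge-edge i j i≢j gij p di ip dp q dj jq dq))) (cong (after edgeEdge) e)
      where
      i≢j = λ q → j≢i (sym q)
      gij : G i j ≡ false
      gij with G i j in ij
      ... | false = refl
      ... | true  = ⊥-elim (j≢p (leaf-neighbour G i di j p ij ip))
    realize edgePath e
      with i , _ , ie ← count-witness _ [] (1≤ (two-edge-ends e))
         | j , _ , jl ← count-witness _ [] (1≤ (two-path-ends e))
      with p , di , ip , dp ← edgeEnd-of i ie | q , dj , jq , dq ← pathEnd-of j jl =
      i , j , i≢j , gij , ≤1 (inj₂ di) , ≤1 (inj₂ dj) ,
      trans (proj₂ (proj₂ (S.step-edge-path i j i≢j gij p di ip dp q dj jq dq))) (cong (after edgePath) e)
      where
      -- the partner of an edge end has degree one, that of a path end degree two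
      i≢j : i ≢ j
      i≢j refl with refl ← leaf-neighbour G i di p q ip jq with () ← trans (sym dp) dq
      gij : G i j ≡ false
      gij with G i j in ij
      ... | false = refl
      ... | true with refl ← leaf-neighbour G i di j p ij ip
                 with refl ← leaf-neighbour G j dj i q (trans (sym-G j i) ij) jq
                 with () ← trans (sym di) dq
    realize pathPath e
      with i , _ , il ← count-witness _ [] (1≤ (two-path-ends e))
      with p , di , ip , dp ← pathEnd-of i il
      with j , (j≢i , _) , jl ← count-witness _ (i ∷ []) (two-path-ends e)
      with q , dj , jq , dq ← pathEnd-of j jl =
      i , j , i≢j , gij , ≤1 (inj₂ di) , ≤1 (inj₂ dj) ,
      trans (proj₂ (proj₂ (S.step-path-path i j i≢j gij p di ip dp q dj jq dq))) (cong (after pathPath) e)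
      where
      i≢j = λ q → j≢i (sym q)
      -- a path end is not adjacent to another end
      gij : G i j ≡ false
      gij with G i j in ij
      ... | false = refl
      ... | true with refl ← leaf-neighbour G i di j p ij ip with () ← trans (sym dj) dp

module LegalMoves {n : ℕ} where
  open DegreeTwo {n}
  open ProfileOf {n}

  edge∈ : ∀ (i j : Fin n) → i <ᶠ j → (i , j) ∈ edgesK n
  edge∈ i j i<j = ∈-filter⁺ (λ e → proj₁ e <ᶠ? proj₂ e)
    (∈-concatMap⁺ (λ x → map (λ y → (x , y)) (allFin n)) (Any.map row (∈-allFin i))) i<j
    where
    row : ∀ {x} → i ≡ x → (i , j) ∈ map (λ y → (x , y)) (allFin n)
    row refl = ∈-map⁺ (λ y → (i , y)) (∈-allFin j)

  legal∈ : ∀ (G : Graph n) i j → i <ᶠ j → LegalMove G (i , j) → (i , j) ∈ legalMoves G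
  legal∈ G i j i<j legal = ∈-filter⁺ (legal? G) (edge∈ i j i<j) legal

  ∈legal : ∀ (G : Graph n) m → m ∈ legalMoves G → proj₁ m <ᶠ proj₂ m × LegalMove G m
  ∈legal G m m∈ = proj₂ (∈-filter⁻ (λ e → proj₁ e <ᶠ? proj₂ e) {xs = pairs} (proj₁ (∈-filter⁻ (legal? G) {xs = edgesK n} m∈))) ,
                  proj₂ (∈-filter⁻ (legal? G) {xs = edgesK n} m∈)
    where pairs = concatMap (λ x → map (λ y → (x , y)) (allFin n)) (allFin n)

  -- A legal move joins two vertices of degree at most one: a vertex of
  -- degree two gaining an edge would be the centre of a claw.
  legal-degrees : ∀ (G : Graph n) → MaxDeg2 G → ∀ i j → i ≢ j → G i j ≡ false → ¬ ContainsClaw (addEdge G i j) →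
    deg G i ≤ 1 × deg G j ≤ 1
  legal-degrees G (sym-G , irr , deg≤2) i j i≢j gij claw-free =
    at-most-one i (deg≤2 i) (deg-i i≢j gij) , at-most-one j (deg≤2 j) (deg-j i≢j (trans (sym-G j i) gij))
    where
    open AddEdge G i j
    cases : ∀ {d} → d ≤ 2 → d ≤ 1 ⊎ d ≡ 2
    cases z≤n             = inj₁ z≤n
    cases (s≤s z≤n)       = inj₁ (s≤s z≤n)
    cases (s≤s (s≤s z≤n)) = inj₂ refl
    at-most-one : ∀ v → deg G v ≤ 2 → deg G' v ≡ suc (deg G v) → deg G v ≤ 1
    at-most-one v d≤2 grows with cases d≤2
    ... | inj₁ d≤1 = d≤1
    ... | inj₂ d≡2 = ⊥-elim (claw-free (claw G' (loopless irr i≢j) v (subst (3 ≤_) (sym (trans grows (cong suc d≡2))) ≤-refl)))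

  legal-move : ∀ (G : Graph n) → Invariant G → ∀ {m} → m ∈ legalMoves G →
    Invariant (addEdge G (proj₁ m) (proj₂ m)) × Move (profile G) (profile (addEdge G (proj₁ m) (proj₂ m)))
  legal-move G inv {i , j} m∈
    with i<j , gij , claw-free ← ∈legal G (i , j) m∈
    with di , dj ← legal-degrees G (proj₁ inv) i j (<⇒≢ i<j) gij claw-free
    = legal-step G inv i j (<⇒≢ i<j) gij di dj

  degrees : ∀ {H : Graph n} → Invariant H → ∀ v → deg H v ≤ 2
  degrees ((_ , _ , deg≤2) , _) = deg≤2

  move-legal : ∀ (G : Graph n) → Invariant G → ∀ {t} → Move (profile G) t →
    ∃ λ m → m ∈ legalMoves G × profile (addEdge G (proj₁ m) (proj₂ m)) ≡ t
  move-legal G inv move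
    with i , j , i≢j , gij , di , dj , reached ← Realize.realize G inv move refl
    with <-cmp i j
  ... | tri< i<j _ _ = (i , j) , legal∈ G i j i<j (gij , noClaw _ (degrees (proj₁ (legal-step G inv i j i≢j gij di dj)))) , reached
  ... | tri≈ _ i≡j _ = ⊥-elim (i≢j i≡j)
  ... | tri> _ _ j<i = (j , i) , legal∈ G j i j<i (gji , noClaw _ (degrees (proj₁ (legal-step G inv j i j≢i gji dj di)))) ,
                       trans (Pointwise.profile-same (addEdge G j i) (addEdge G i j) (addEdge-comm G i j)) reached
    where
    gji = trans (proj₁ (proj₁ inv) j i) gij
    j≢i = λ q → i≢j (sym q)

module Optimum {A : Set} where

  maxOver-cong : ∀ (f g : A → ℕ) e es → (∀ {m} → m ∈ e ∷ es → f m ≡ g m) → maxOver f e es ≡ maxOver g e es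
  maxOver-cong f g e []       same = same (here refl)
  maxOver-cong f g e (y ∷ ys) same = cong₂ _⊔_ (same (here refl)) (maxOver-cong f g y ys (λ m∈ → same (there m∈)))

  minOver-cong : ∀ (f g : A → ℕ) e es → (∀ {m} → m ∈ e ∷ es → f m ≡ g m) → minOver f e es ≡ minOver g e es
  minOver-cong f g e []       same = same (here refl)
  minOver-cong f g e (y ∷ ys) same = cong₂ _⊓_ (same (here refl)) (minOver-cong f g y ys (λ m∈ → same (there m∈)))

  ⊔-∸ : ∀ k x y → (k ∸ indicator x) ⊔ (k ∸ indicator y) ≡ k ∸ indicator (x ∧ y)
  ⊔-∸ k true  true  = ⊔-idem (k ∸ 1)
  ⊔-∸ k true  false = m≤n⇒m⊔n≡n (m∸n≤m k 1)
  ⊔-∸ k false true  = m≥n⇒m⊔n≡m (m∸n≤m k 1)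
  ⊔-∸ k false false = ⊔-idem k

  ⊓-∸ : ∀ k x y → (k ∸ indicator x) ⊓ (k ∸ indicator y) ≡ k ∸ indicator (x ∨ y)
  ⊓-∸ k true  true  = ⊓-idem (k ∸ 1)
  ⊓-∸ k true  false = m≤n⇒m⊓n≡m (m∸n≤m k 1)
  ⊓-∸ k false true  = m≥n⇒m⊓n≡n (m∸n≤m k 1)
  ⊓-∸ k false false = ⊓-idem k

  maxOver-∸ : ∀ (h : A → Bool) k e es → maxOver (λ m → k ∸ indicator (h m)) e es ≡ k ∸ indicator (all h (e ∷ es))
  maxOver-∸ h k e []       = cong (λ b → k ∸ indicator b) (sym (∧-identityʳ (h e)))
  maxOver-∸ h k e (y ∷ ys) = trans (cong ((k ∸ indicator (h e)) ⊔_) (maxOver-∸ h k y ys)) (⊔-∸ k (h e) (all h (y ∷ ys)))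

  minOver-∸ : ∀ (h : A → Bool) k e es → minOver (λ m → k ∸ indicator (h m)) e es ≡ k ∸ indicator (any h (e ∷ es))
  minOver-∸ h k e []       = cong (λ b → k ∸ indicator b) (sym (∨-identityʳ (h e)))
  minOver-∸ h k e (y ∷ ys) = trans (cong ((k ∸ indicator (h e)) ⊓_) (minOver-∸ h k y ys)) (⊓-∸ k (h e) (any h (y ∷ ys)))

-- The value of the game: from a position G with p to move, optimal play
-- adds exactly potential ∸ [survives] further edges, since every move
-- lowers the potential by one and the game stops at potential zero or one.
module GameValue {n : ℕ} where
  open DegreeTwo {n}
  open ProfileOf {n}
  open LegalMoves {n}
  open Optimum

  terminal-value : ∀ s → (∀ t → ¬ Move s t) → potential s ∸ indicator (nonempty s) ≡ 0
  terminal-value (0 , 0 , 0)              _     = refl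
  terminal-value (1 , 0 , 0)              _     = refl
  terminal-value (0 , 1 , 0)              _     = refl
  terminal-value (a , b , suc c)          stuck = ⊥-elim (stuck _ pathPath)
  terminal-value (suc (suc a) , b , 0)    stuck = ⊥-elim (stuck _ isoIso)
  terminal-value (suc a , suc b , 0)      stuck = ⊥-elim (stuck _ isoEdge)
  terminal-value (0 , suc (suc b) , 0)    stuck = ⊥-elim (stuck _ edgeEdge)

  play : Graph n → Fin n × Fin n → Graph n
  play G m = addEdge G (proj₁ m) (proj₂ m)

  Value : ℕ → Player → Graph n → Set
  Value f p G = Invariant G → potential (profile G) ≤ f →
    gameValue f p G ≡ potential (profile G) ∸ indicator (survives p (profile G))

  module Turn (G : Graph n) (inv : Invariant G) (e : Fin n × Fin n) (es : List (Fin n × Fin n))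
              (moves : legalMoves G ≡ e ∷ es) where
    s = profile G

    next : Fin n × Fin n → Profile
    next m = profile (play G m)

    step : ∀ {m} → m ∈ e ∷ es → Invariant (play G m) × Move s (next m)
    step m∈ = legal-move G inv (subst (_ ∈_) (sym moves) m∈)

    reach : ∀ {t} → Move s t → ∃ λ m → m ∈ e ∷ es × next m ≡ t
    reach move with m , m∈ , reached ← move-legal G inv move = m , subst (_ ∈_) moves m∈ , reached

    -- all moves lead to the same potential P'
    P' = potential (next e)

    potential-s : potential s ≡ suc P'
    potential-s = move-potential (proj₂ (step (here refl)))

    potential-next : ∀ {m} → m ∈ e ∷ es → potential (next m) ≡ P'
    potential-next m∈ = suc-injective (trans (sym (move-potential (proj₂ (step m∈)))) potential-s)

    successor-value : ∀ f q → (∀ H → Value f q H) → potential s ≤ suc f → ∀ {m} → m ∈ e ∷ es →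
      gameValue f q (play G m) ≡ P' ∸ indicator (survives q (next m))
    successor-value f q value bound {m} m∈ =
      trans (value _ (proj₁ (step m∈)) (≤-pred (subst (_≤ suc f) (trans potential-s (cong suc (sym (potential-next m∈)))) bound)))
            (cong (_∸ indicator (survives q (next m))) (potential-next m∈))

    move₀ : Move s (next e)
    move₀ = proj₂ (step (here refl))

    max-bridge : all (λ m → survives Min (next m)) (e ∷ es) ≡ survives Max s
    max-bridge with survives Max s in sMax
    ... | true = all-true-intro _ (e ∷ es)
                   (λ m∈ → allMoves-true (survives Min) s (trans (sym (survives-Max move₀)) sMax) (proj₂ (step m∈)))
    ... | false with t , move , t-dies ← allMoves-false (survives Min) s (trans (sym (survives-Max move₀)) sMax)
                with m , m∈ , refl ← reach move = all-false-intro _ (e ∷ es) m∈ t-dies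

    min-bridge : any (λ m → survives Max (next m)) (e ∷ es) ≡ survives Min s
    min-bridge with survives Min s in sMin
    ... | true with t , move , t-survives ← anyMove-true (survives Max) s (trans (sym (survives-Min move₀)) sMin)
               with m , m∈ , refl ← reach move = any-true-intro _ (e ∷ es) m∈ t-survives
    ... | false = any-false-intro _ (e ∷ es)
                    (λ m∈ → anyMove-false (survives Max) s (trans (sym (survives-Min move₀)) sMin) (proj₂ (step m∈)))

    -- the move just played is counted
    finish : ∀ x → (x ≡ true → 1 ≤ P') → suc (P' ∸ indicator x) ≡ potential s ∸ indicator x
    finish false _   = sym potential-s
    finish true  pos = trans (suc-pred (pos refl)) (sym (cong (_∸ 1) potential-s))
      where
      suc-pred : ∀ {k} → 1 ≤ k → suc (k ∸ 1) ≡ k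
      suc-pred (s≤s _) = refl

    max-value : ∀ f → (∀ H → Value f Min H) → potential s ≤ suc f →
      suc (maxOver (λ m → gameValue f Min (play G m)) e es) ≡ potential s ∸ indicator (survives Max s)
    max-value f value bound = begin
      suc (maxOver (λ m → gameValue f Min (play G m)) e es)
        ≡⟨ cong suc (maxOver-cong _ _ e es (successor-value f Min value bound)) ⟩
      suc (maxOver (λ m → P' ∸ indicator (survives Min (next m))) e es)
        ≡⟨ cong suc (maxOver-∸ (λ m → survives Min (next m)) P' e es) ⟩
      suc (P' ∸ indicator (all (λ m → survives Min (next m)) (e ∷ es)))
        ≡⟨ cong (λ x → suc (P' ∸ indicator x)) max-bridge ⟩
      suc (P' ∸ indicator (survives Max s))
        ≡⟨ finish (survives Max s) some-left ⟩
      potential s ∸ indicator (survives Max s) ∎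
      where
      open ≡-Reasoning
      some-left : survives Max s ≡ true → 1 ≤ P'
      some-left sMax = survives-potential Min (next e)
        (all-true _ (e ∷ es) (trans max-bridge sMax) (here refl))

    min-value : ∀ f → (∀ H → Value f Max H) → potential s ≤ suc f →
      suc (minOver (λ m → gameValue f Max (play G m)) e es) ≡ potential s ∸ indicator (survives Min s)
    min-value f value bound = begin
      suc (minOver (λ m → gameValue f Max (play G m)) e es)
        ≡⟨ cong suc (minOver-cong _ _ e es (successor-value f Max value bound)) ⟩
      suc (minOver (λ m → P' ∸ indicator (survives Max (next m))) e es)
        ≡⟨ cong suc (minOver-∸ (λ m → survives Max (next m)) P' e es) ⟩
      suc (P' ∸ indicator (any (λ m → survives Max (next m)) (e ∷ es)))
        ≡⟨ cong (λ x → suc (P' ∸ indicator x)) min-bridge ⟩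
      suc (P' ∸ indicator (survives Min s))
        ≡⟨ finish (survives Min s) some-left ⟩
      potential s ∸ indicator (survives Min s) ∎
      where
      open ≡-Reasoning
      some-left : survives Min s ≡ true → 1 ≤ P'
      some-left sMin with m , m∈ , m-survives ← any-true _ (e ∷ es) (trans min-bridge sMin) =
        subst (1 ≤_) (potential-next m∈) (survives-potential Max (next m) m-survives)

  finished : ∀ p (G : Graph n) → Invariant G → legalMoves G ≡ [] →
    potential (profile G) ∸ indicator (survives p (profile G)) ≡ 0
  finished p G inv none = trans (cong (λ b → potential (profile G) ∸ indicator b) (survives-terminal p _ stuck))
                                (terminal-value _ stuck)
    where
    stuck : ∀ t → ¬ Move (profile G) t
    stuck t move with m , m∈ , _ ← move-legal G inv move with () ← subst (m ∈_) none m∈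

  value : ∀ f p (G : Graph n) → Value f p G
  value zero p G inv bound = sym (trans (cong (_∸ indicator (survives p (profile G))) (n≤0⇒n≡0 bound)) (0∸n≡0 (indicator (survives p (profile G)))))
  value (suc f) Max G inv bound with legalMoves G in moves
  ... | []     = sym (finished Max G inv moves)
  ... | e ∷ es = Turn.max-value G inv e es moves f (value f Min) bound
  value (suc f) Min G inv bound with legalMoves G in moves
  ... | []     = sym (finished Min G inv moves)
  ... | e ∷ es = Turn.min-value G inv e es moves f (value f Max) bound

module Start {n : ℕ} where
  open DegreeTwo {n}
  open ProfileOf {n}

  typeBits-empty : ∀ v → typeBits (empty {n}) v ≡ isolatedBits
  typeBits-empty v = typeBits-correct empty v (isolated (count-false n))

  countType-empty : ∀ sel → countType sel (empty {n}) ≡ count {n} (λ _ → sel isolatedBits)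
  countType-empty sel = count-cong _ _ (λ v → cong sel (typeBits-empty v))

  invariant-empty : Invariant (empty {n})
  invariant-empty =
    ((λ _ _ → refl) , (λ _ → refl) , (λ v → subst (_≤ 2) (sym (count-false n)) z≤n)) ,
    (0 , trans (countType-empty edgeEndBit) (count-false n)) ,
    (0 , trans (countType-empty pathEndBit) (count-false n))

  profile-empty : profile (empty {n}) ≡ (n , 0 , 0)
  profile-empty rewrite countType-empty isolatedBit | countType-empty edgeEndBit | countType-empty pathEndBit
                      | count-true n | count-false n = refl

start-value : ∀ n p → gameValue {n} (n * n) p empty ≡ n ∸ indicator (survives p (n , 0 , 0))
start-value n p = begin
  gameValue (n * n) p empty
    ≡⟨ GameValue.value (n * n) p empty invariant-empty (subst (λ s → potential s ≤ n * n) (sym profile-empty) (n≤n*n n)) ⟩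
  potential (profile empty) ∸ indicator (survives p (profile empty))
    ≡⟨ cong (λ s → potential s ∸ indicator (survives p s)) profile-empty ⟩
  (n + 0) ∸ indicator (survives p (n , 0 , 0))
    ≡⟨ cong (_∸ indicator (survives p (n , 0 , 0))) (+-identityʳ n) ⟩
  n ∸ indicator (survives p (n , 0 , 0)) ∎
  where
  open ≡-Reasoning
  open Start {n}
  open ProfileOf {n}
  n≤n*n : ∀ n → n + 0 ≤ n * n
  n≤n*n zero    = z≤n
  n≤n*n (suc k) = subst (_≤ suc k * suc k) (sym (+-identityʳ (suc k))) (m≤m*n (suc k) (suc k))

-- When Max starts, all n vertices are covered by cycles exactly when
-- n ∈ {3 , 7} or n is even and not 2; when Min starts, exactly when n is
-- not even or n = 4.
MaxCovers MinFails : ℕ → Set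
MaxCovers n = n ≡ 3 ⊎ n ≡ 7 ⊎ (2 ∣ n × n ≢ 2)
MinFails  n = 2 ∣ n × n ≢ 4

maxCovers? : ∀ n → Dec (MaxCovers n)
maxCovers? n = (n ≟ℕ 3) ⊎-dec (n ≟ℕ 7) ⊎-dec ((2 ∣? n) ×-dec ¬? (n ≟ℕ 2))

minFails? : ∀ n → Dec (MinFails n)
minFails? n = (2 ∣? n) ×-dec ¬? (n ≟ℕ 4)

-- Reading the table at the start profiles (checked below 12, periodic beyond).
start-Max : ∀ n → survives Max (n , 0 , 0) ≡ not (does (maxCovers? n))
start-Max = periodic-induction _
  (λ k k<12 → ⇔ᵇ-sound (all-true (λ k → survives Max (k , 0 , 0) ⇔ᵇ not (does (maxCovers? k))) (upTo 12) refl (∈-upTo⁺ k<12)))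
  (λ _ h → h)

start-Min : ∀ m → survives Min (2 + m , 0 , 0) ≡ does (minFails? (2 + m))
start-Min = periodic-induction _
  (λ k k<12 → ⇔ᵇ-sound (all-true (λ k → survives Min (2 + k , 0 , 0) ⇔ᵇ does (minFails? (2 + k))) (upTo 12) refl (∈-upTo⁺ k<12)))
  (λ _ h → h)

satg-covers : ∀ n → MaxCovers n → satg n ≡ n
satg-covers n covers =
  trans (start-value n Max) (cong (λ b → n ∸ indicator b) (trans (start-Max n) (cong not (dec-true (maxCovers? n) covers))))

satg-short : ∀ n → ¬ MaxCovers n → satg n ≡ n ∸ 1
satg-short n ¬covers =
  trans (start-value n Max) (cong (λ b → n ∸ indicator b) (trans (start-Max n) (cong not (dec-false (maxCovers? n) ¬covers))))

satg′-short : ∀ n → 2 ≤ n → MinFails n → satg' n ≡ n ∸ 1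
satg′-short 1 (s≤s ())
satg′-short (suc (suc m)) _ fails =
  trans (start-value (2 + m) Min) (cong (λ b → (2 + m) ∸ indicator b) (trans (start-Min m) (dec-true (minFails? (2 + m)) fails)))

satg′-covers : ∀ n → 2 ≤ n → ¬ MinFails n → satg' n ≡ n
satg′-covers 1 (s≤s ())
satg′-covers (suc (suc m)) _ ¬fails =
  trans (start-value (2 + m) Min) (cong (λ b → (2 + m) ∸ indicator b) (trans (start-Min m) (dec-false (minFails? (2 + m)) ¬fails)))

parity : ∀ n → ∃ λ k → n ≡ k + k ⊎ n ≡ suc (k + k)
parity zero = 0 , inj₁ refl
parity (suc n) with parity n
... | k , inj₁ refl = k , inj₂ refl
... | k , inj₂ refl = suc k , inj₁ (cong suc (sym (+-suc k k)))

2∣double : ∀ k → 2 ∣ k + k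
2∣double k = subst (2 ∣_) (cong (k +_) (+-identityʳ k)) (m∣m*n k)

¬2∣odd : ∀ k → ¬ 2 ∣ suc (k + k)
¬2∣odd k 2∣odd with () ← ∣1⇒≡1 (∣m+n∣m⇒∣n (subst (2 ∣_) (+-comm 1 (k + k)) 2∣odd) (2∣double k))

half-odd : ∀ k → ⌊ suc (k + k) /2⌋ ≡ k
half-odd zero    = refl
half-odd (suc k) = cong suc (trans (cong ⌊_/2⌋ (+-suc k k)) (half-odd k))

double : ∀ k → k + k ≡ 2 * k
double k = cong (k +_) (sym (+-identityʳ k))

even-large : ∀ k → 8 ≤ k + k → (satg (k + k) ≡ 2 * ⌊ k + k /2⌋) × (satg' (k + k) ≡ 2 * ⌈ k + k /2⌉ ∸ 1)
even-large k 8≤n =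
  trans (satg-covers (k + k) (inj₂ (inj₂ (2∣double k , small 2 (≤ᵇ⇒≤ 2 7 _)))))
        (trans (double k) (cong (2 *_) (n≡⌊n+n/2⌋ k))) ,
  trans (satg′-short (k + k) (≤-trans (≤ᵇ⇒≤ 2 8 _) 8≤n) (2∣double k , small 4 (≤ᵇ⇒≤ 4 7 _)))
        (cong (_∸ 1) (trans (double k) (cong (2 *_) (sym (half-odd k)))))
  where
  small : ∀ m → m ≤ 7 → k + k ≢ m
  small m m≤7 refl = 1+n≰n (≤-trans 8≤n m≤7)

odd-large : ∀ k → 8 ≤ suc (k + k) →
  (satg (suc (k + k)) ≡ 2 * ⌊ suc (k + k) /2⌋) × (satg' (suc (k + k)) ≡ 2 * ⌈ suc (k + k) /2⌉ ∸ 1)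
odd-large k 8≤n =
  trans (satg-short (suc (k + k)) not-covered) (trans (double k) (cong (2 *_) (sym (half-odd k)))) ,
  trans (satg′-covers (suc (k + k)) (≤-trans (≤ᵇ⇒≤ 2 8 _) 8≤n) (λ (2∣n , _) → ¬2∣odd k 2∣n)) odd-length
  where
  small : ∀ m → m ≤ 7 → suc (k + k) ≢ m
  small m m≤7 refl = 1+n≰n (≤-trans 8≤n m≤7)
  not-covered : ¬ MaxCovers (suc (k + k))
  not-covered (inj₁ n≡3)              = small 3 (≤ᵇ⇒≤ 3 7 _) n≡3
  not-covered (inj₂ (inj₁ n≡7))       = small 7 (≤ᵇ⇒≤ 7 7 _) n≡7
  not-covered (inj₂ (inj₂ (2∣n , _))) = ¬2∣odd k 2∣n
  odd-length : suc (k + k) ≡ 2 * ⌈ suc (k + k) /2⌉ ∸ 1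
  odd-length = begin
    suc (k + k)             ≡⟨ cong suc (double k) ⟩
    suc (k + (k + 0))       ≡⟨ +-suc k (k + 0) ⟨
    2 * suc k ∸ 1           ≡⟨ cong (λ h → 2 * suc h ∸ 1) (n≡⌊n+n/2⌋ k) ⟩
    2 * suc ⌊ k + k /2⌋ ∸ 1 ∎
    where open ≡-Reasoning

large : ∀ n → 8 ≤ n → (satg n ≡ 2 * ⌊ n /2⌋) × (satg' n ≡ 2 * ⌈ n /2⌉ ∸ 1)
large n = by-parity (parity n)
  where
  by-parity : ∀ {n} → (∃ λ k → n ≡ k + k ⊎ n ≡ suc (k + k)) →
    8 ≤ n → (satg n ≡ 2 * ⌊ n /2⌋) × (satg' n ≡ 2 * ⌈ n /2⌉ ∸ 1)
  by-parity (k , inj₁ refl) = even-large k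
  by-parity (k , inj₂ refl) = odd-large k

mainTheorem3 : (n : ℕ) → 2 ≤ n →
    (((n ≡ 3 ⊎ n ≡ 7 ⊎ (2 ∣ n × n ≢ 2)) → satg n ≡ n) ×
     (¬ (n ≡ 3 ⊎ n ≡ 7 ⊎ (2 ∣ n × n ≢ 2)) → satg n ≡ n ∸ 1) ×
     ((2 ∣ n × n ≢ 4) → satg' n ≡ n ∸ 1) ×
     (¬ (2 ∣ n × n ≢ 4) → satg' n ≡ n)) ×
    (8 ≤ n → (satg n ≡ 2 * ⌊ n /2⌋) × (satg' n ≡ 2 * ⌈ n /2⌉ ∸ 1))
mainTheorem3 n 2≤n =
  (satg-covers n , satg-short n , satg′-short n 2≤n , satg′-covers n 2≤n) , large n
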